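{- Let $N=p_1^{\alpha_1}\cdots p_k^{\alpha_k}$ with distinct primes $p_j$ and $\alpha_j\ge1$, and let $A(X),B(X),C(X),D(X)$ be polynomials modulo $X^N-1$ with integer coefficients, with weight functions $w_A,w_B,w_C,w_D:\mathbb{Z}_N\to\mathbb{Z}$ (coefficient of $X^x$). For $m\mid N$ set $\mathbb{A}^N_m[C]=\sum_{a,c\in\mathbb{Z}_N}w_A(a)w_C(c)\mathbf 1_{\gcd(a-c,N)=m}$ and similarly $\mathbb{B}^N_m[D]$. Then $$\sum_{m\mid N}\frac{1}{\phi(N/m)}\mathbb{A}^N_m[C]\,\mathbb{B}^N_m[D]=\sum_{d\mid N}\frac{1}{N\phi(d)}\Big[\sum_{\zeta:\Phi_d(\zeta)=0}A(\zeta)\overline{C(\zeta)}\Big]\Big[\sum_{\zeta:\Phi_d(\zeta)=0}B(\zeta)\overline{D(\zeta)}\Big].$$ In particular, $$\sum_{m\mid N}\frac{1}{\phi(N/m)}\mathbb{A}^N_m[A]\,\mathbb{B}^N_m[B]=\sum_{d\mid N}\frac{1}{N\phi(d)}\mathcal{E}_d(A)\mathcal{E}_d(B),\qquad \mathcal{E}_d(A)=\sum_{\zeta:\Phi_d(\zeta)=0}|A(\zeta)|^2.$$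
   Context: $\phi$ is Euler's totient function and $\Phi_d$ the $d$-th cyclotomic polynomial; the inner sums run over the primitive $d$-th roots of unity $\zeta$. -}

module Defs where

open import Level using (_⊔_) renaming (suc to lsuc)
open import Algebra.Bundles using (CommutativeRing)
open import Data.Nat as ℕ using (ℕ; zero; suc; NonZero; _∸_)
open import Data.Nat.GCD using (gcd)
open import Data.Nat.Divisibility using (_∣?_)
open import Data.Nat.DivMod using (_%_; _/_)
open import Data.Integer as ℤ using (ℤ; +_; -[1+_])
open import Data.Fin using (Fin; toℕ)
open import Data.Bool using (if_then_else_)
open import Relation.Nullary using (¬_; does)
open import Relation.Binary.PropositionalEquality using (_≡_)
open import Data.Product using (_×_)

ringFromℕ : ∀ {c ℓ} (R : CommutativeRing c ℓ) → ℕ → CommutativeRing.Carrier R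
ringFromℕ R zero    = CommutativeRing.0# R
ringFromℕ R (suc n) = CommutativeRing._+_ R (CommutativeRing.1# R) (ringFromℕ R n)

record CharZeroField (c ℓ : Level.Level) : Set (lsuc (c ⊔ ℓ)) where
  field
    commRing : CommutativeRing c ℓ
  open CommutativeRing commRing public
  fromℕ : ℕ → Carrier
  fromℕ = ringFromℕ commRing
  field
    _⁻¹      : Carrier → Carrier
    inverseʳ : ∀ x → ¬ (x ≈ 0#) → x * (x ⁻¹) ≈ 1#
    charZero : ∀ n → ¬ (fromℕ (suc n) ≈ 0#)

sumℕ : (n : ℕ) → (Fin n → ℕ) → ℕ
sumℕ zero    f = 0
sumℕ (suc n) f = f Fin.zero ℕ.+ sumℕ n (λ i → f (Fin.suc i))
  where import Data.Fin as Fin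

φ : ℕ → ℕ
φ n = sumℕ n (λ i → if does (gcd (suc (toℕ i)) n ℕ.≟ 1) then 1 else 0)

sumℤ : (n : ℕ) → (Fin n → ℤ) → ℤ
sumℤ zero    f = + 0
sumℤ (suc n) f = f Fin.zero ℤ.+ sumℤ n (λ i → f (Fin.suc i))
  where import Data.Fin as Fin

-- gcd(a - c, N) for a, c ∈ ℤ_N (computed on the representative of a - c in [0, N))
gcdDiff : (N : ℕ) .{{_ : NonZero N}} → Fin N → Fin N → ℕ
gcdDiff N a c = gcd (((toℕ a ℕ.+ N) ∸ toℕ c) % N) N

𝔸 : (N : ℕ) .{{_ : NonZero N}} → (Fin N → ℤ) → (Fin N → ℤ) → ℕ → ℤ
𝔸 N wA wC m = sumℤ N (λ a → sumℤ N (λ c →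
   if does (gcdDiff N a c ℕ.≟ m) then wA a ℤ.* wC c else + 0))

module Over {c ℓ} (F : CharZeroField c ℓ) where
  open CharZeroField F

  fromℤ : ℤ → Carrier
  fromℤ (+ n)    = fromℕ n
  fromℤ -[1+ n ] = - fromℕ (suc n)

  _^_ : Carrier → ℕ → Carrier
  x ^ zero  = 1#
  x ^ suc n = x * (x ^ n)

  ∑ : (n : ℕ) → (Fin n → Carrier) → Carrier
  ∑ zero    f = 0#
  ∑ (suc n) f = f Fin.zero + ∑ n (λ i → f (Fin.suc i))
    where import Data.Fin as Fin

  ∑∣ : (N : ℕ) → (ℕ → Carrier) → Carrier
  ∑∣ N f = ∑ N (λ i → if does (suc (toℕ i) ∣? N) then f (suc (toℕ i)) else 0#)

  IsPrimitiveRoot : ℕ → Carrier → Set ℓ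
  IsPrimitiveRoot N ζ = (ζ ^ N ≈ 1#) × (∀ k → 0 ℕ.< k → k ℕ.< N → ¬ (ζ ^ k ≈ 1#))

  eval : (N : ℕ) → (Fin N → ℤ) → Carrier → Carrier
  eval N w r = ∑ N (λ x → fromℤ (w x) * (r ^ toℕ x))

  -- Σ_{ζ' : Φ_d(ζ') = 0} A(ζ') · conj(C(ζ')), where the primitive d-th roots
  -- of unity are ζ^x (x ∈ ℤ_N, gcd(x,N) = N/d) and, for integer polynomials,
  -- conj(C(ζ^x)) = C(ζ^(N-x)).
  S : (N : ℕ) → Carrier → ℕ → (Fin N → ℤ) → (Fin N → ℤ) → Carrier
  S N ζ d wA wC = ∑ N (λ x →
     if does ((gcd (toℕ x) N ℕ.* d) ℕ.≟ N)
     then eval N wA (ζ ^ toℕ x) * eval N wC (ζ ^ (N ∸ toℕ x))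
     else 0#)

  𝓔 : (N : ℕ) → Carrier → ℕ → (Fin N → ℤ) → Carrier
  𝓔 N ζ d wA = S N ζ d wA wA

  LHS : (N : ℕ) .{{_ : NonZero N}} → (wA wB wC wD : Fin N → ℤ) → Carrier
  LHS N wA wB wC wD = ∑∣ N (λ m →
     (fromℕ (φ (N / suc (m ∸ 1)))) ⁻¹ * (fromℤ (𝔸 N wA wC m) * fromℤ (𝔸 N wB wD m)))

  RHS : (N : ℕ) → Carrier → (wA wB wC wD : Fin N → ℤ) → Carrier
  RHS N ζ wA wB wC wD = ∑∣ N (λ d →
     (fromℕ (N ℕ.* φ d)) ⁻¹ * (S N ζ d wA wC * S N ζ d wB wD))

  RHS𝓔 : (N : ℕ) → Carrier → (wA wB : Fin N → ℤ) → Carrier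
  RHS𝓔 N ζ wA wB = ∑∣ N (λ d →
     (fromℕ (N ℕ.* φ d)) ⁻¹ * (𝓔 N ζ d wA * 𝓔 N ζ d wB))

-- Both sides are bilinear in w_A(a)w_C(c) and w_B(b)w_D(e) and see (a,c), (b,e) only through
-- u = a - c and v = b - e modulo N, so it suffices to compare kernels. The divisor side gives
-- K(u,v) = [gcd(u,N) = gcd(v,N)] / φ(N / gcd(u,N)), φ(N/m) being the number of residues y with
-- gcd(y,N) = m. On the root side, writing the Ramanujan sums c_d(u) as sums of ζ^(xu) over
-- gcd(x,N)·d = N and summing over d first turns (1/N) Σ_d c_d(u) c_d(v) / φ(d) into
-- (1/N) Σ_{x,y} ζ^(xu + yv) K(x,y). The transform Σ_y K(x,y) ζ^(yv) is symmetric in x and v,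
-- because Σ_{gcd(y,N)=m} ζ^(yu) depends on u only through gcd(u,N); this follows by downward
-- induction on m from the geometric sums over all multiples of m. Orthogonality of the
-- characters then collapses the double sum to K(v, -u) = K(u, v).

module Submission where

open import Defs
open import Data.Nat using (ℕ; NonZero)
open import Data.Integer using (ℤ)
open import Data.Fin using (Fin)
open import Data.Product using (_×_)

open import Data.Bool using (if_then_else_)
open import Data.Empty using (⊥-elim)
open import Data.Fin using (toℕ)
import Data.Fin as Fin
import Data.Fin.Properties as Finₚ
import Data.Integer as ℤ
import Data.Integer.Properties as ℤₚ
open import Data.Nat using (zero; suc; _∸_; _<_; _≤_; z≤n; s≤s)
import Data.Nat as ℕ
import Data.Nat.Properties as ℕₚ
open import Data.Nat.Divisibility using (_∣_; _∣?_; divides)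
import Data.Nat.Divisibility as ∣
open import Data.Nat.DivMod using (_%_; _/_; m≡m%n+[m/n]*n; m%n<n; m*[n/m]≡n; /-congʳ)
open import Data.Nat.GCD
  using (gcd; gcd[m,n]≢0; gcd-greatest; gcd[m,n]∣m; gcd[m,n]∣n; gcd-zeroˡ; gcd-identityˡ; gcd[m,n]≤n;
         c*gcd[m,n]≡gcd[cm,cn]; n/gcd[m,n]≢0)
open import Data.Nat.Induction using (<-wellFounded)
open import Data.Nat.Tactic.RingSolver using (solve-∀)
open import Data.Product using (_,_; proj₁; proj₂)
open import Data.Sign using (Sign)
import Data.Sign as Sign
open import Data.Sum using (inj₂)
open import Function using (_∘_; it)
open import Induction.WellFounded using (Acc; acc)
open import Level using (Level)
open import Relation.Binary.PropositionalEquality as ≡ using (_≡_; _≢_)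
open import Relation.Nullary using (¬_; Dec; yes; no; does; ¬?; _×-dec_)

∣-respects-gcd : ∀ {d n u u′} → d ∣ n → gcd u n ≡ gcd u′ n → d ∣ u → d ∣ u′
∣-respects-gcd {d} {n} {u} {u′} d∣n gcd≡ d∣u =
  ∣.∣-trans (≡.subst (d ∣_) gcd≡ (gcd-greatest d∣u d∣n)) (gcd[m,n]∣m u′ n)

gcd[n∸s,n]≡gcd[s,n] : ∀ {s n} → s ≤ n → gcd (n ∸ s) n ≡ gcd s n
gcd[n∸s,n]≡gcd[s,n] {s} {n} s≤n = ∣.∣-antisym
  (gcd-greatest (∣.∣m+n∣m⇒∣n (≡.subst (gcd (n ∸ s) n ∣_) (≡.sym (ℕₚ.m∸n+n≡m s≤n))
                                      (gcd[m,n]∣n (n ∸ s) n))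
                             (gcd[m,n]∣m (n ∸ s) n))
                (gcd[m,n]∣n (n ∸ s) n))
  (gcd-greatest (∣.∣m+n∣m⇒∣n (≡.subst (gcd s n ∣_) (≡.sym (ℕₚ.m+[n∸m]≡n s≤n)) (gcd[m,n]∣n s n))
                             (gcd[m,n]∣m s n))
                (gcd[m,n]∣n s n))

φ≢0 : ∀ {n} → n ≢ 0 → φ n ≢ 0
φ≢0 {zero}  n≢0 _   = n≢0 ≡.refl
φ≢0 {suc n} _   φ≡0 = ℕₚ.1+n≢0 (≡.trans (≡.sym 1st-term≡1) (ℕₚ.m+n≡0⇒m≡0 _ φ≡0))
  where
  1st-term≡1 : (if does (gcd 1 (suc n) ℕ.≟ 1) then 1 else 0) ≡ 1
  1st-term≡1 rewrite gcd-zeroˡ (suc n) = ≡.refl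

negate : ℕ → ℕ → ℕ
negate n zero    = zero
negate n (suc u) = n ∸ suc u

negate-< : ∀ {n u} → u < n → negate n u < n
negate-< {n} {zero}  0<n = 0<n
negate-< {n} {suc u} u<n = ℕₚ.∸-monoʳ-< (s≤s z≤n) (ℕₚ.<⇒≤ u<n)

∣+negate : ∀ {n u} → u < n → n ∣ u ℕ.+ negate n u
∣+negate {n} {zero}  _   = n ∣.∣0
∣+negate {n} {suc u} u<n = ≡.subst (n ∣_) (≡.sym (ℕₚ.m+[n∸m]≡n (ℕₚ.<⇒≤ u<n))) ∣.∣-refl

negate-unique : ∀ {n u y} → u < n → y < n → n ∣ u ℕ.+ y → y ≡ negate n u
negate-unique {u = zero}  {zero}  _   _   _   = ≡.refl
negate-unique {u = zero}  {suc y} _   y<n n∣y = ⊥-elim (ℕₚ.<⇒≱ y<n (∣.∣⇒≤ n∣y))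
negate-unique {n} {suc u} {y} u<n y<n (divides (suc zero) u+y≡n+0) =
  ≡.trans (≡.sym (ℕₚ.m+n∸m≡n (suc u) y)) (≡.cong (_∸ suc u) (≡.trans u+y≡n+0 (ℕₚ.+-identityʳ n)))
negate-unique {n} {suc u} {y} u<n y<n (divides (suc (suc k)) u+y≡[2+k]n) =
  ⊥-elim (ℕₚ.<⇒≱ (ℕₚ.+-mono-< u<n y<n)
    (≡.subst (n ℕ.+ n ℕ.≤_) (≡.sym u+y≡[2+k]n) (ℕₚ.+-monoʳ-≤ n (ℕₚ.m≤m+n n (k ℕ.* n)))))

gcd-negate : ∀ {n u} → u < n → gcd (negate n u) n ≡ gcd u n
gcd-negate {n} {zero}  _   = ≡.refl
gcd-negate {n} {suc u} u<n = gcd[n∸s,n]≡gcd[s,n] (ℕₚ.<⇒≤ u<n)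

*-rightComm : ∀ m n o → m ℕ.* n ℕ.* o ≡ m ℕ.* o ℕ.* n
*-rightComm = solve-∀

module CharZeroFieldProperties {c ℓ} (F : CharZeroField c ℓ) where
  open CharZeroField F
  open Over F
  open import Algebra.Properties.Semiring.Sum semiring public
    using (sum; sum-cong-≋; sum-replicate-zero; sum-init-last; ∑-comm; ∑-distrib-+;
           *-distribˡ-sum; *-distribʳ-sum)
  open import Algebra.Properties.CommutativeSemigroup *-commutativeSemigroup public
    using (interchange; x∙yz≈y∙xz; xy∙z≈y∙xz)
  open import Algebra.Properties.Group +-group public using () renaming (∙-cancelʳ to +-cancelʳ)
  open import Algebra.Properties.Group +-group using (ε⁻¹≈ε; ⁻¹-involutive; x∙y⁻¹≈ε⇒x≈y)
  open import Algebra.Definitions _≈_ using (AlmostLeftCancellative)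
  open import Algebra.Properties.AbelianGroup +-abelianGroup using (⁻¹-∙-comm)
  open import Algebra.Properties.Ring ring using (-1*x≈-x)
  open import Relation.Binary.Reasoning.Setoid setoid

  fromℕ-+ : ∀ m n → fromℕ (m ℕ.+ n) ≈ fromℕ m + fromℕ n
  fromℕ-+ zero    n = sym (+-identityˡ _)
  fromℕ-+ (suc m) n = trans (+-congˡ (fromℕ-+ m n)) (sym (+-assoc _ _ _))

  fromℕ-* : ∀ m n → fromℕ (m ℕ.* n) ≈ fromℕ m * fromℕ n
  fromℕ-* zero    n = sym (zeroˡ _)
  fromℕ-* (suc m) n = begin
    fromℕ (n ℕ.+ m ℕ.* n)             ≈⟨ fromℕ-+ n (m ℕ.* n) ⟩
    fromℕ n + fromℕ (m ℕ.* n)         ≈⟨ +-cong (sym (*-identityˡ _)) (fromℕ-* m n) ⟩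
    1# * fromℕ n + fromℕ m * fromℕ n  ≈⟨ distribʳ _ _ _ ⟨
    (1# + fromℕ m) * fromℕ n          ∎

  fromℕ-sumℕ : ∀ n (f : Fin n → ℕ) → fromℕ (sumℕ n f) ≈ sum (fromℕ ∘ f)
  fromℕ-sumℕ zero    f = refl
  fromℕ-sumℕ (suc n) f = trans (fromℕ-+ (f Fin.zero) _) (+-congˡ (fromℕ-sumℕ n (f ∘ Fin.suc)))

  fromℤ-⊖ : ∀ m n → fromℤ (m ℤ.⊖ n) ≈ fromℕ m - fromℕ n
  fromℤ-⊖ m zero rewrite ℤₚ.⊖-≥ {m} {0} z≤n =
    sym (trans (+-congˡ ε⁻¹≈ε) (+-identityʳ _))
  fromℤ-⊖ zero (suc n) rewrite ℤₚ.⊖-< {0} {suc n} (s≤s z≤n) = sym (+-identityˡ _)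
  fromℤ-⊖ (suc m) (suc n) rewrite ℤₚ.[1+m]⊖[1+n]≡m⊖n m n = begin
    fromℤ (m ℤ.⊖ n)                       ≈⟨ fromℤ-⊖ m n ⟩
    fromℕ m - fromℕ n                     ≈⟨ +-congʳ (+-identityˡ _) ⟨
    0# + fromℕ m - fromℕ n                ≈⟨ +-congʳ (+-congʳ (-‿inverseʳ 1#)) ⟨
    1# - 1# + fromℕ m - fromℕ n           ≈⟨ +-congʳ (xy∙z≈xz∙y 1# (- 1#) (fromℕ m)) ⟩
    1# + fromℕ m - 1# - fromℕ n           ≈⟨ +-assoc _ _ _ ⟩
    1# + fromℕ m + (- 1# - fromℕ n)       ≈⟨ +-congˡ (⁻¹-∙-comm 1# (fromℕ n)) ⟩
    (1# + fromℕ m) - (1# + fromℕ n)       ∎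
    where open import Algebra.Properties.CommutativeSemigroup +-commutativeSemigroup using (xy∙z≈xz∙y)

  fromℤ-+ : ∀ z w → fromℤ (z ℤ.+ w) ≈ fromℤ z + fromℤ w
  fromℤ-+ (ℤ.+ m)    (ℤ.+ n)    = fromℕ-+ m n
  fromℤ-+ (ℤ.+ m)    ℤ.-[1+ n ] = fromℤ-⊖ m (suc n)
  fromℤ-+ ℤ.-[1+ m ] (ℤ.+ n)    = trans (fromℤ-⊖ n (suc m)) (+-comm _ _)
  fromℤ-+ ℤ.-[1+ m ] ℤ.-[1+ n ] = begin
    - fromℕ (suc (suc (m ℕ.+ n)))    ≡⟨ ≡.cong (λ k → - fromℕ (suc k)) (ℕₚ.+-suc m n) ⟨
    - fromℕ (suc m ℕ.+ suc n)        ≈⟨ -‿cong (fromℕ-+ (suc m) (suc n)) ⟩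
    - (fromℕ (suc m) + fromℕ (suc n)) ≈⟨ ⁻¹-∙-comm _ _ ⟨
    - fromℕ (suc m) - fromℕ (suc n)  ∎

  sign : Sign → Carrier
  sign Sign.+ = 1#
  sign Sign.- = - 1#

  sign-* : ∀ s t → sign (s Sign.* t) ≈ sign s * sign t
  sign-* Sign.+ t      = sym (*-identityˡ _)
  sign-* Sign.- Sign.+ = sym (*-identityʳ _)
  sign-* Sign.- Sign.- = sym (trans (-1*x≈-x _) (⁻¹-involutive _))

  fromℤ-◃ : ∀ s n → fromℤ (s ℤ.◃ n) ≈ sign s * fromℕ n
  fromℤ-◃ s      zero    = sym (zeroʳ _)
  fromℤ-◃ Sign.+ (suc n) = sym (*-identityˡ _)
  fromℤ-◃ Sign.- (suc n) = sym (-1*x≈-x _)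

  fromℤ≈sign*∣∣ : ∀ z → fromℤ z ≈ sign (ℤ.sign z) * fromℕ ℤ.∣ z ∣
  fromℤ≈sign*∣∣ (ℤ.+ n)    = sym (*-identityˡ _)
  fromℤ≈sign*∣∣ ℤ.-[1+ n ] = sym (-1*x≈-x _)

  fromℤ-* : ∀ z w → fromℤ (z ℤ.* w) ≈ fromℤ z * fromℤ w
  fromℤ-* z w = begin
    fromℤ (z ℤ.* w)
      ≈⟨ fromℤ-◃ (ℤ.sign z Sign.* ℤ.sign w) (ℤ.∣ z ∣ ℕ.* ℤ.∣ w ∣) ⟩
    sign (ℤ.sign z Sign.* ℤ.sign w) * fromℕ (ℤ.∣ z ∣ ℕ.* ℤ.∣ w ∣)
      ≈⟨ *-cong (sign-* (ℤ.sign z) (ℤ.sign w)) (fromℕ-* ℤ.∣ z ∣ ℤ.∣ w ∣) ⟩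
    (sign (ℤ.sign z) * sign (ℤ.sign w)) * (fromℕ ℤ.∣ z ∣ * fromℕ ℤ.∣ w ∣)
      ≈⟨ interchange _ _ _ _ ⟩
    (sign (ℤ.sign z) * fromℕ ℤ.∣ z ∣) * (sign (ℤ.sign w) * fromℕ ℤ.∣ w ∣)
      ≈⟨ *-cong (fromℤ≈sign*∣∣ z) (fromℤ≈sign*∣∣ w) ⟨
    fromℤ z * fromℤ w ∎

  fromℤ-sumℤ : ∀ n (f : Fin n → ℤ) → fromℤ (sumℤ n f) ≈ sum (fromℤ ∘ f)
  fromℤ-sumℤ zero    f = refl
  fromℤ-sumℤ (suc n) f = trans (fromℤ-+ (f Fin.zero) _) (+-congˡ (fromℤ-sumℤ n (f ∘ Fin.suc)))

  fromℕ≉0 : ∀ {n} → n ≢ 0 → fromℕ n ≉ 0#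
  fromℕ≉0 {zero}  0≢0 = ⊥-elim (0≢0 ≡.refl)
  fromℕ≉0 {suc n} _   = charZero n

  *-inverseˡ : ∀ x → x ≉ 0# → x ⁻¹ * x ≈ 1#
  *-inverseˡ x x≉0 = trans (*-comm _ _) (inverseʳ x x≉0)

  x⁻¹*[x*y]≈y : ∀ {x} y → x ≉ 0# → x ⁻¹ * (x * y) ≈ y
  x⁻¹*[x*y]≈y {x} y x≉0 = begin
    x ⁻¹ * (x * y) ≈⟨ *-assoc _ _ _ ⟨
    x ⁻¹ * x * y   ≈⟨ *-congʳ (*-inverseˡ x x≉0) ⟩
    1# * y         ≈⟨ *-identityˡ y ⟩
    y              ∎

  *-almostCancelˡ : AlmostLeftCancellative 0# _*_
  *-almostCancelˡ x y z x≉0 xy≈xz = begin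
    y              ≈⟨ x⁻¹*[x*y]≈y y x≉0 ⟨
    x ⁻¹ * (x * y) ≈⟨ *-congˡ xy≈xz ⟩
    x ⁻¹ * (x * z) ≈⟨ x⁻¹*[x*y]≈y z x≉0 ⟩
    z              ∎

  ≉0-* : ∀ {x y} → x ≉ 0# → y ≉ 0# → x * y ≉ 0#
  ≉0-* {x} {y} x≉0 y≉0 xy≈0 = y≉0 (*-almostCancelˡ x y 0# x≉0 (trans xy≈0 (sym (zeroʳ x))))

  ⁻¹-unique : ∀ {x y} → x ≉ 0# → x * y ≈ 1# → y ≈ x ⁻¹
  ⁻¹-unique {x} {y} x≉0 xy≈1 = *-almostCancelˡ x y (x ⁻¹) x≉0 (trans xy≈1 (sym (inverseʳ x x≉0)))

  ⁻¹-cong : ∀ {x y} → x ≈ y → x ≉ 0# → x ⁻¹ ≈ y ⁻¹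
  ⁻¹-cong {x} x≈y x≉0 = ⁻¹-unique (x≉0 ∘ trans x≈y) (trans (*-congʳ (sym x≈y)) (inverseʳ x x≉0))

  ⁻¹-distrib-* : ∀ {x y} → x ≉ 0# → y ≉ 0# → (x * y) ⁻¹ ≈ x ⁻¹ * y ⁻¹
  ⁻¹-distrib-* {x} {y} x≉0 y≉0 = sym (⁻¹-unique (≉0-* x≉0 y≉0) (begin
    x * y * (x ⁻¹ * y ⁻¹)     ≈⟨ interchange _ _ _ _ ⟩
    x * x ⁻¹ * (y * y ⁻¹)     ≈⟨ *-cong (inverseʳ x x≉0) (inverseʳ y y≉0) ⟩
    1# * 1#                   ≈⟨ *-identityˡ 1# ⟩
    1#                        ∎))

  ⁻¹*-cross : ∀ {x y} a b → x ≉ 0# → y ≉ 0# → y * a ≈ x * b → x ⁻¹ * a ≈ y ⁻¹ * b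
  ⁻¹*-cross {x} {y} a b x≉0 y≉0 ya≈xb = begin
    x ⁻¹ * a                    ≈⟨ *-congˡ (x⁻¹*[x*y]≈y a y≉0) ⟨
    x ⁻¹ * (y ⁻¹ * (y * a))     ≈⟨ *-congˡ (*-congˡ ya≈xb) ⟩
    x ⁻¹ * (y ⁻¹ * (x * b))     ≈⟨ x∙yz≈y∙xz _ _ _ ⟩
    y ⁻¹ * (x ⁻¹ * (x * b))     ≈⟨ *-congˡ (x⁻¹*[x*y]≈y b x≉0) ⟩
    y ⁻¹ * b                    ∎

  ^-+ : ∀ x m n → x ^ (m ℕ.+ n) ≈ x ^ m * x ^ n
  ^-+ x zero    n = sym (*-identityˡ _)
  ^-+ x (suc m) n = trans (*-congˡ (^-+ x m n)) (sym (*-assoc _ _ _))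

  ^-distrib-* : ∀ x y n → (x * y) ^ n ≈ x ^ n * y ^ n
  ^-distrib-* x y zero    = sym (*-identityˡ 1#)
  ^-distrib-* x y (suc n) = trans (*-congˡ (^-distrib-* x y n)) (interchange _ _ _ _)

  ^-≈1 : ∀ {x} → x ≈ 1# → ∀ n → x ^ n ≈ 1#
  ^-≈1 x≈1 zero    = refl
  ^-≈1 x≈1 (suc n) = trans (*-cong x≈1 (^-≈1 x≈1 n)) (*-identityˡ 1#)

  ^-* : ∀ x m n → x ^ (m ℕ.* n) ≈ (x ^ m) ^ n
  ^-* x zero    n = sym (^-≈1 refl n)
  ^-* x (suc m) n = begin
    x ^ (n ℕ.+ m ℕ.* n)       ≈⟨ ^-+ x n (m ℕ.* n) ⟩
    x ^ n * x ^ (m ℕ.* n)     ≈⟨ *-congˡ (^-* x m n) ⟩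
    x ^ n * (x ^ m) ^ n       ≈⟨ ^-distrib-* x (x ^ m) n ⟨
    (x * x ^ m) ^ n           ∎

  ^≈^% : ∀ {q} n .{{_ : NonZero n}} → q ^ n ≈ 1# → ∀ k → q ^ k ≈ q ^ (k % n)
  ^≈^% {q} n qⁿ≈1 k = begin
    q ^ k                             ≡⟨ ≡.cong (q ^_) (m≡m%n+[m/n]*n k n) ⟩
    q ^ (k % n ℕ.+ k / n ℕ.* n)       ≈⟨ ^-+ q (k % n) _ ⟩
    q ^ (k % n) * q ^ (k / n ℕ.* n)   ≡⟨ ≡.cong (λ e → q ^ (k % n) * q ^ e) (ℕₚ.*-comm (k / n) n) ⟩
    q ^ (k % n) * q ^ (n ℕ.* (k / n)) ≈⟨ *-congˡ (^-* q n (k / n)) ⟩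
    q ^ (k % n) * (q ^ n) ^ (k / n)   ≈⟨ *-congˡ (^-≈1 qⁿ≈1 (k / n)) ⟩
    q ^ (k % n) * 1#                  ≈⟨ *-identityʳ _ ⟩
    q ^ (k % n)                       ∎

  ^-*-inverse : ∀ {p q} → p * q ≈ 1# → ∀ {n} → q ^ n ≈ 1# → ∀ a c → c ≤ a ℕ.+ n →
                q ^ a * p ^ c ≈ q ^ (a ℕ.+ n ∸ c)
  ^-*-inverse {p} {q} pq≈1 {n} qⁿ≈1 a c c≤a+n = begin
    q ^ a * p ^ c                       ≈⟨ *-congʳ (*-identityʳ _) ⟨
    q ^ a * 1# * p ^ c                  ≈⟨ *-congʳ (*-congˡ qⁿ≈1) ⟨
    q ^ a * q ^ n * p ^ c               ≈⟨ *-congʳ (^-+ q a n) ⟨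
    q ^ (a ℕ.+ n) * p ^ c               ≡⟨ ≡.cong (λ e → q ^ e * p ^ c) (ℕₚ.m∸n+n≡m c≤a+n) ⟨
    q ^ (k ℕ.+ c) * p ^ c               ≈⟨ *-congʳ (^-+ q k c) ⟩
    q ^ k * q ^ c * p ^ c               ≈⟨ *-assoc _ _ _ ⟩
    q ^ k * (q ^ c * p ^ c)             ≈⟨ *-congˡ (^-distrib-* q p c) ⟨
    q ^ k * (q * p) ^ c                 ≈⟨ *-congˡ (^-≈1 (trans (*-comm q p) pq≈1) c) ⟩
    q ^ k * 1#                          ≈⟨ *-identityʳ _ ⟩
    q ^ k                               ∎
    where k = a ℕ.+ n ∸ c

  𝟙 : ∀ {p} {P : Set p} → Dec P → Carrier
  𝟙 (yes _) = 1#
  𝟙 (no _)  = 0#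

  private variable
    p q : Level
    P : Set p
    Q : Set q

  𝟙*-yes : (P? : Dec P) → P → ∀ x → 𝟙 P? * x ≈ x
  𝟙*-yes (yes _) _  x = *-identityˡ x
  𝟙*-yes (no ¬p) p  x = ⊥-elim (¬p p)

  𝟙*-no : (P? : Dec P) → ¬ P → ∀ x → 𝟙 P? * x ≈ 0#
  𝟙*-no (yes p) ¬p x = ⊥-elim (¬p p)
  𝟙*-no (no _)  _  x = zeroˡ x

  𝟙*-cong : (P? : Dec P) → ∀ {x y} → (P → x ≈ y) → 𝟙 P? * x ≈ 𝟙 P? * y
  𝟙*-cong (yes p) x≈y = *-congˡ (x≈y p)
  𝟙*-cong (no _)  _   = trans (zeroˡ _) (sym (zeroˡ _))

  𝟙-cong : (P? : Dec P) (Q? : Dec Q) → (P → Q) → (Q → P) → 𝟙 P? ≈ 𝟙 Q?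
  𝟙-cong (yes _) (yes _) _ _ = refl
  𝟙-cong (yes p) (no ¬q) f _ = ⊥-elim (¬q (f p))
  𝟙-cong (no ¬p) (yes q) _ g = ⊥-elim (¬p (g q))
  𝟙-cong (no _)  (no _)  _ _ = refl

  𝟙*𝟙-absorb : (P? : Dec P) (Q? : Dec Q) → (P → Q) → 𝟙 Q? * 𝟙 P? ≈ 𝟙 P?
  𝟙*𝟙-absorb (yes p) Q? P⇒Q = 𝟙*-yes Q? (P⇒Q p) 1#
  𝟙*𝟙-absorb (no _)  Q? _   = zeroʳ (𝟙 Q?)

  𝟙-split : (P? : Dec P) (Q? : Dec Q) → (Q → P) → 𝟙 P? ≈ 𝟙 Q? + 𝟙 (P? ×-dec ¬? Q?)
  𝟙-split (yes _) (yes _) _   = sym (+-identityʳ 1#)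
  𝟙-split (yes _) (no _)  _   = sym (+-identityˡ 1#)
  𝟙-split (no ¬p) (yes q) Q⇒P = ⊥-elim (¬p (Q⇒P q))
  𝟙-split (no _)  (no _)  _   = sym (+-identityˡ 0#)

  if-does≈𝟙* : (P? : Dec P) → ∀ x → (if does P? then x else 0#) ≈ 𝟙 P? * x
  if-does≈𝟙* (yes _) x = sym (*-identityˡ x)
  if-does≈𝟙* (no _)  x = sym (zeroˡ x)

  fromℕ-if-does : (P? : Dec P) → fromℕ (if does P? then 1 else 0) ≈ 𝟙 P?
  fromℕ-if-does (yes _) = +-identityʳ 1#
  fromℕ-if-does (no _)  = refl

  fromℤ-if-does : (P? : Dec P) → ∀ z → fromℤ (if does P? then z else ℤ.+ 0) ≈ 𝟙 P? * fromℤ z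
  fromℤ-if-does (yes _) z = sym (*-identityˡ _)
  fromℤ-if-does (no _)  z = sym (zeroˡ _)

  ∑≡sum : ∀ n (f : Fin n → Carrier) → ∑ n f ≡ sum f
  ∑≡sum zero    f = ≡.refl
  ∑≡sum (suc n) f = ≡.cong (f Fin.zero +_) (∑≡sum n (f ∘ Fin.suc))

  ∑< : ℕ → (ℕ → Carrier) → Carrier
  ∑< n h = sum {n} (h ∘ toℕ)

  ∑<-cong : ∀ n {h h′ : ℕ → Carrier} → (∀ j → j < n → h j ≈ h′ j) → ∑< n h ≈ ∑< n h′
  ∑<-cong n h≈h′ = sum-cong-≋ {n} (λ i → h≈h′ (toℕ i) (Finₚ.toℕ<n i))

  ∑<-zero : ∀ n {h : ℕ → Carrier} → (∀ j → j < n → h j ≈ 0#) → ∑< n h ≈ 0#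
  ∑<-zero n h≈0 = trans (∑<-cong n h≈0) (sum-replicate-zero n)

  ∑<-1 : ∀ n → ∑< n (λ _ → 1#) ≈ fromℕ n
  ∑<-1 zero    = refl
  ∑<-1 (suc n) = +-congˡ (∑<-1 n)

  ∑<-single : ∀ n (h : ℕ → Carrier) k → k < n → (∀ j → j < n → j ≢ k → h j ≈ 0#) → ∑< n h ≈ h k
  ∑<-single (suc n) h zero    _         h≈0 = begin
    h 0 + ∑< n (h ∘ suc) ≈⟨ +-congˡ (∑<-zero n (λ j j<n → h≈0 (suc j) (s≤s j<n) λ ())) ⟩
    h 0 + 0#             ≈⟨ +-identityʳ _ ⟩
    h 0                  ∎
  ∑<-single (suc n) h (suc k) (s≤s k<n) h≈0 = begin
    h 0 + ∑< n (h ∘ suc) ≈⟨ +-cong (h≈0 0 (s≤s z≤n) λ ()) (∑<-single n (h ∘ suc) k k<n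
                              λ j j<n j≢k → h≈0 (suc j) (s≤s j<n) (j≢k ∘ ℕₚ.suc-injective)) ⟩
    0# + h (suc k)       ≈⟨ +-identityˡ _ ⟩
    h (suc k)            ∎

  ∑<-suc-single : ∀ n (h : ℕ → Carrier) {k} → 0 < k → k ≤ n →
                  (∀ j → j < n → suc j ≢ k → h (suc j) ≈ 0#) → ∑< n (h ∘ suc) ≈ h k
  ∑<-suc-single n h {suc k} _ k<n h≈0 =
    ∑<-single n (h ∘ suc) k k<n (λ j j<n j≢k → h≈0 j j<n (j≢k ∘ ℕₚ.suc-injective))

  ∑<-+ : ∀ m n (h : ℕ → Carrier) → ∑< (m ℕ.+ n) h ≈ ∑< m h + ∑< n (λ j → h (m ℕ.+ j))
  ∑<-+ zero    n h = sym (+-identityˡ _)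
  ∑<-+ (suc m) n h = trans (+-congˡ (∑<-+ m n (h ∘ suc))) (sym (+-assoc _ _ _))

  ∑<-rotate : ∀ n (h : ℕ → Carrier) → h 0 ≈ h n → ∑< n (h ∘ suc) ≈ ∑< n h
  ∑<-rotate n h h0≈hn = +-cancelʳ (h 0) _ _ (begin
    ∑< n (h ∘ suc) + h 0                        ≈⟨ +-comm _ _ ⟩
    ∑< (suc n) h                                ≈⟨ sum-init-last {n} (h ∘ toℕ) ⟩
    sum {n} (h ∘ toℕ ∘ Fin.inject₁) + h (toℕ (Fin.fromℕ n))
      ≈⟨ +-cong (sum-cong-≋ {n} (λ i → reflexive (≡.cong h (Finₚ.toℕ-inject₁ i))))
                (reflexive (≡.cong h (Finₚ.toℕ-fromℕ n))) ⟩
    ∑< n h + h n                                ≈⟨ +-congˡ h0≈hn ⟨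
    ∑< n h + h 0                                ∎)

  ∑<-multiples : ∀ m n (h : ℕ → Carrier) .{{_ : NonZero m}} →
                 ∑< (m ℕ.* n) (λ y → 𝟙 (m ∣? y) * h y) ≈ ∑< n (λ j → h (m ℕ.* j))
  ∑<-multiples m zero    h rewrite ℕₚ.*-zeroʳ m = refl
  ∑<-multiples m (suc n) h rewrite ℕₚ.*-suc m n = begin
    ∑< (m ℕ.+ m ℕ.* n) (λ y → 𝟙 (m ∣? y) * h y)
      ≈⟨ ∑<-+ m (m ℕ.* n) (λ y → 𝟙 (m ∣? y) * h y) ⟩
    ∑< m (λ y → 𝟙 (m ∣? y) * h y) + ∑< (m ℕ.* n) (λ j → 𝟙 (m ∣? m ℕ.+ j) * h (m ℕ.+ j))
      ≈⟨ +-cong first (∑<-cong (m ℕ.* n) λ j _ → *-congʳ {h (m ℕ.+ j)} (𝟙-cong (m ∣? m ℕ.+ j) (m ∣? j)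
           (λ m∣m+j → ∣.∣m+n∣m⇒∣n m∣m+j ∣.∣-refl) (∣.∣m∣n⇒∣m+n ∣.∣-refl))) ⟩
    h 0 + ∑< (m ℕ.* n) (λ j → 𝟙 (m ∣? j) * h (m ℕ.+ j))
      ≈⟨ +-cong (reflexive (≡.cong h (≡.sym (ℕₚ.*-zeroʳ m)))) (∑<-multiples m n (h ∘ (m ℕ.+_))) ⟩
    h (m ℕ.* 0) + ∑< n (λ j → h (m ℕ.+ m ℕ.* j))
      ≈⟨ +-congˡ (∑<-cong n λ j _ → reflexive (≡.cong h (ℕₚ.*-suc m j))) ⟨
    h (m ℕ.* 0) + ∑< n (λ j → h (m ℕ.* suc j)) ∎
    where
    first : ∑< m (λ y → 𝟙 (m ∣? y) * h y) ≈ h 0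
    first = begin
      ∑< m (λ y → 𝟙 (m ∣? y) * h y)
        ≈⟨ ∑<-single m (λ y → 𝟙 (m ∣? y) * h y) 0 (ℕ.>-nonZero⁻¹ m) (λ j j<m j≢0 →
             𝟙*-no (m ∣? j) (∣.>⇒∤ {{ℕ.≢-nonZero j≢0}} j<m) (h j)) ⟩
      𝟙 (m ∣? 0) * h 0 ≈⟨ 𝟙*-yes (m ∣? 0) (m ∣.∣0) (h 0) ⟩
      h 0              ∎

  *-distribˡ-∑< : ∀ n x (h : ℕ → Carrier) → x * ∑< n h ≈ ∑< n (λ j → x * h j)
  *-distribˡ-∑< n x h = *-distribˡ-sum {n} x (h ∘ toℕ)

  *-distribʳ-∑< : ∀ n x (h : ℕ → Carrier) → ∑< n h * x ≈ ∑< n (λ j → h j * x)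
  *-distribʳ-∑< n x h = *-distribʳ-sum {n} x (h ∘ toℕ)

  ∑<-comm : ∀ m n (h : ℕ → ℕ → Carrier) →
            ∑< m (λ i → ∑< n (h i)) ≈ ∑< n (λ j → ∑< m (λ i → h i j))
  ∑<-comm m n h = ∑-comm {m} {n} (λ i j → h (toℕ i) (toℕ j))

  sum-*-sum : ∀ {m n} (f : Fin m → Carrier) (g : Fin n → Carrier) →
              sum f * sum g ≈ sum (λ i → sum (λ j → f i * g j))
  sum-*-sum {m} f g = trans (*-distribʳ-sum _ f) (sum-cong-≋ {m} λ i → *-distribˡ-sum (f i) g)

  ∑<-∑<-factor : ∀ n c (a b : ℕ → Carrier) (K : ℕ → ℕ → Carrier) →
                 ∑< n (λ x → ∑< n (λ y → (a x * b y) * (c * K x y))) ≈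
                 c * ∑< n (λ x → a x * ∑< n (λ y → K x y * b y))
  ∑<-∑<-factor n c a b K = begin
    ∑< n (λ x → ∑< n (λ y → (a x * b y) * (c * K x y)))
      ≈⟨ ∑<-cong n (λ x _ → ∑<-cong n (λ y _ → rearrange (a x) (b y) (K x y))) ⟩
    ∑< n (λ x → ∑< n (λ y → c * (a x * (K x y * b y))))
      ≈⟨ ∑<-cong n (λ x _ → trans (*-congˡ (*-distribˡ-∑< n (a x) (λ y → K x y * b y)))
                                   (*-distribˡ-∑< n c (λ y → a x * (K x y * b y)))) ⟨
    ∑< n (λ x → c * (a x * ∑< n (λ y → K x y * b y)))
      ≈⟨ *-distribˡ-∑< n c (λ x → a x * ∑< n (λ y → K x y * b y)) ⟨
    c * ∑< n (λ x → a x * ∑< n (λ y → K x y * b y)) ∎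
    where
    rearrange : ∀ a b k → (a * b) * (c * k) ≈ c * (a * (k * b))
    rearrange a b k = trans (x∙yz≈y∙xz _ c k) (*-congˡ (trans (*-assoc a b k) (*-congˡ (*-comm b k))))

  ∑<-∑<-swap-factor : ∀ n (a : ℕ → Carrier) (K : ℕ → Carrier) (b : ℕ → ℕ → Carrier) →
                      ∑< n (λ x → a x * ∑< n (λ y → K y * b x y)) ≈
                      ∑< n (λ y → K y * ∑< n (λ x → a x * b x y))
  ∑<-∑<-swap-factor n a K b = begin
    ∑< n (λ x → a x * ∑< n (λ y → K y * b x y))
      ≈⟨ ∑<-cong n (λ x _ → *-distribˡ-∑< n (a x) (λ y → K y * b x y)) ⟩
    ∑< n (λ x → ∑< n (λ y → a x * (K y * b x y)))
      ≈⟨ ∑<-comm n n (λ x y → a x * (K y * b x y)) ⟩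
    ∑< n (λ y → ∑< n (λ x → a x * (K y * b x y)))
      ≈⟨ ∑<-cong n (λ y _ → ∑<-cong n (λ x _ → x∙yz≈y∙xz (a x) (K y) (b x y))) ⟩
    ∑< n (λ y → ∑< n (λ x → K y * (a x * b x y)))
      ≈⟨ ∑<-cong n (λ y _ → *-distribˡ-∑< n (K y) (λ x → a x * b x y)) ⟨
    ∑< n (λ y → K y * ∑< n (λ x → a x * b x y)) ∎

  ∑<-geometric-root : ∀ {q} n → q ≉ 1# → q ^ n ≈ 1# → ∑< n (q ^_) ≈ 0#
  ∑<-geometric-root {q} n q≉1 qⁿ≈1 = *-almostCancelˡ (q - 1#) _ 0# q-1≉0 (begin
    (q - 1#) * ∑< n (q ^_)              ≈⟨ distribʳ _ _ _ ⟩
    q * ∑< n (q ^_) + - 1# * ∑< n (q ^_) ≈⟨ +-cong (*-distribˡ-∑< n q (q ^_)) (-1*x≈-x _) ⟩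
    ∑< n (q ^_ ∘ suc) - ∑< n (q ^_)      ≈⟨ +-congʳ (∑<-rotate n (q ^_) (sym qⁿ≈1)) ⟩
    ∑< n (q ^_) - ∑< n (q ^_)            ≈⟨ -‿inverseʳ _ ⟩
    0#                                   ≈⟨ zeroʳ _ ⟨
    (q - 1#) * 0#                        ∎)
    where
    q-1≉0 : q - 1# ≉ 0#
    q-1≉0 = q≉1 ∘ x∙y⁻¹≈ε⇒x≈y q 1#

  φ≈∑< : ∀ n → fromℕ (φ n) ≈ ∑< n (λ j → 𝟙 (gcd j n ℕ.≟ 1))
  φ≈∑< n = begin
    fromℕ (φ n)                             ≈⟨ fromℕ-sumℕ n _ ⟩
    ∑< n (λ j → fromℕ (if does (gcd (suc j) n ℕ.≟ 1) then 1 else 0))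
      ≈⟨ ∑<-cong n (λ j _ → fromℕ-if-does (gcd (suc j) n ℕ.≟ 1)) ⟩
    ∑< n (λ j → 𝟙 (gcd (suc j) n ℕ.≟ 1))   ≈⟨ ∑<-rotate n (λ j → 𝟙 (gcd j n ℕ.≟ 1)) gcd[0,n]≈gcd[n,n] ⟩
    ∑< n (λ j → 𝟙 (gcd j n ℕ.≟ 1))         ∎
    where
    gcd[n,n]≡n : gcd n n ≡ n
    gcd[n,n]≡n = ∣.∣-antisym (gcd[m,n]∣m n n) (gcd-greatest ∣.∣-refl ∣.∣-refl)
    gcd[0,n]≈gcd[n,n] : 𝟙 (gcd 0 n ℕ.≟ 1) ≈ 𝟙 (gcd n n ℕ.≟ 1)
    gcd[0,n]≈gcd[n,n] =
      reflexive (≡.cong (λ g → 𝟙 (g ℕ.≟ 1)) (≡.trans (gcd-identityˡ n) (≡.sym gcd[n,n]≡n)))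

  ∑∣≈∑< : ∀ n (f : ℕ → Carrier) → ∑∣ n f ≈ ∑< n (λ i → 𝟙 (suc i ∣? n) * f (suc i))
  ∑∣≈∑< n f = trans (reflexive (∑≡sum n λ i → if does (suc (toℕ i) ∣? n) then f (suc (toℕ i)) else 0#))
                    (∑<-cong n (λ i _ → if-does≈𝟙* (suc i ∣? n) (f (suc i))))

  ∑∣-cong : ∀ n (f g : ℕ → Carrier) → (∀ d → f d ≈ g d) → ∑∣ n f ≈ ∑∣ n g
  ∑∣-cong n f g f≈g = begin
    ∑∣ n f                                    ≈⟨ ∑∣≈∑< n f ⟩
    ∑< n (λ i → 𝟙 (suc i ∣? n) * f (suc i))  ≈⟨ ∑<-cong n (λ i _ → *-congˡ {𝟙 (suc i ∣? n)} (f≈g (suc i))) ⟩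
    ∑< n (λ i → 𝟙 (suc i ∣? n) * g (suc i))  ≈⟨ ∑∣≈∑< n g ⟨
    ∑∣ n g                                    ∎

  ∑∣-single : ∀ n .{{_ : NonZero n}} (f : ℕ → Carrier) {k} → k ∣ n →
              (∀ m → m ≢ k → f m ≈ 0#) → ∑∣ n f ≈ f k
  ∑∣-single n f {k} k∣n f≈0 = begin
    ∑∣ n f
      ≈⟨ ∑∣≈∑< n f ⟩
    ∑< n (λ i → 𝟙 (suc i ∣? n) * f (suc i))
      ≈⟨ ∑<-suc-single n (λ m → 𝟙 (m ∣? n) * f m) 0<k (∣.∣⇒≤ k∣n)
           (λ j _ j+1≢k → trans (*-congˡ (f≈0 (suc j) j+1≢k)) (zeroʳ _)) ⟩
    𝟙 (k ∣? n) * f k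
      ≈⟨ 𝟙*-yes (k ∣? n) k∣n (f k) ⟩
    f k ∎
    where
    0<k : 0 < k
    0<k = ℕₚ.n≢0⇒n>0 λ k≡0 → ℕ.≢-nonZero⁻¹ n (∣.0∣⇒≡0 (≡.subst (_∣ n) k≡0 k∣n))

  *-distribˡ-∑∣ : ∀ n x (f : ℕ → Carrier) → x * ∑∣ n f ≈ ∑∣ n (λ d → x * f d)
  *-distribˡ-∑∣ n x f = begin
    x * ∑∣ n f
      ≈⟨ *-congˡ (∑∣≈∑< n f) ⟩
    x * ∑< n (λ i → 𝟙 (suc i ∣? n) * f (suc i))
      ≈⟨ *-distribˡ-∑< n x (λ i → 𝟙 (suc i ∣? n) * f (suc i)) ⟩
    ∑< n (λ i → x * (𝟙 (suc i ∣? n) * f (suc i)))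
      ≈⟨ ∑<-cong n (λ i _ → x∙yz≈y∙xz x (𝟙 (suc i ∣? n)) (f (suc i))) ⟩
    ∑< n (λ i → 𝟙 (suc i ∣? n) * (x * f (suc i)))
      ≈⟨ ∑∣≈∑< n (λ d → x * f d) ⟨
    ∑∣ n (λ d → x * f d) ∎

  ∑∣-sum : ∀ n {m} (f : ℕ → Fin m → Carrier) →
           ∑∣ n (λ d → sum (f d)) ≈ sum (λ i → ∑∣ n (λ d → f d i))
  ∑∣-sum n {m} f = begin
    ∑∣ n (λ d → sum (f d))
      ≈⟨ ∑∣≈∑< n (λ d → sum (f d)) ⟩
    ∑< n (λ j → 𝟙 (suc j ∣? n) * sum (f (suc j)))
      ≈⟨ ∑<-cong n (λ j _ → *-distribˡ-sum (𝟙 (suc j ∣? n)) (f (suc j))) ⟩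
    ∑< n (λ j → sum (λ i → 𝟙 (suc j ∣? n) * f (suc j) i))
      ≈⟨ ∑-comm {n} {m} (λ j i → 𝟙 (suc (toℕ j) ∣? n) * f (suc (toℕ j)) i) ⟩
    sum (λ i → ∑< n (λ j → 𝟙 (suc j ∣? n) * f (suc j) i))
      ≈⟨ sum-cong-≋ {m} (λ i → ∑∣≈∑< n (λ d → f d i)) ⟨
    sum (λ i → ∑∣ n (λ d → f d i)) ∎

  ∑∣-*-sum : ∀ n {k m} (κ : ℕ → Carrier) (f : ℕ → Fin k → Carrier) (g : ℕ → Fin m → Carrier) →
             ∑∣ n (λ d → κ d * (sum (f d) * sum (g d))) ≈
             sum (λ i → sum (λ j → ∑∣ n (λ d → κ d * (f d i * g d j))))
  ∑∣-*-sum n {k} κ f g = begin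
    ∑∣ n (λ d → κ d * (sum (f d) * sum (g d)))
      ≈⟨ ∑∣-cong n _ (λ d → sum (λ i → sum (λ j → κ d * (f d i * g d j)))) (λ d →
           trans (*-congˡ (sum-*-sum (f d) (g d)))
                 (trans (*-distribˡ-sum (κ d) (λ i → sum (λ j → f d i * g d j)))
                        (sum-cong-≋ {k} λ i → *-distribˡ-sum (κ d) (λ j → f d i * g d j)))) ⟩
    ∑∣ n (λ d → sum (λ i → sum (λ j → κ d * (f d i * g d j))))
      ≈⟨ ∑∣-sum n (λ d i → sum (λ j → κ d * (f d i * g d j))) ⟩
    sum (λ i → ∑∣ n (λ d → sum (λ j → κ d * (f d i * g d j))))
      ≈⟨ sum-cong-≋ {k} (λ i → ∑∣-sum n (λ d j → κ d * (f d i * g d j))) ⟩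
    sum (λ i → sum (λ j → ∑∣ n (λ d → κ d * (f d i * g d j)))) ∎

  ∑∣-*-pull : ∀ n (κ α β : ℕ → Carrier) a b →
              ∑∣ n (λ d → κ d * ((α d * a) * (β d * b))) ≈ (a * b) * ∑∣ n (λ d → κ d * (α d * β d))
  ∑∣-*-pull n κ α β a b = begin
    ∑∣ n (λ d → κ d * ((α d * a) * (β d * b)))
      ≈⟨ ∑∣-cong n _ _ (λ d → trans (*-congˡ (trans (interchange (α d) a (β d) b) (*-comm _ _)))
                                     (x∙yz≈y∙xz (κ d) (a * b) _)) ⟩
    ∑∣ n (λ d → (a * b) * (κ d * (α d * β d)))  ≈⟨ *-distribˡ-∑∣ n (a * b) (λ d → κ d * (α d * β d)) ⟨
    (a * b) * ∑∣ n (λ d → κ d * (α d * β d))    ∎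

module PrimitiveRoot {c ℓ} (F : CharZeroField c ℓ) (N : ℕ) .{{_ : NonZero N}}
                     (ζ : CharZeroField.Carrier F) (ζ-primitive : Over.IsPrimitiveRoot F N ζ) where
  open CharZeroField F
  open Over F
  open CharZeroFieldProperties F
  open import Relation.Binary.Reasoning.Setoid setoid

  0<gcd[y,N] : ∀ y → 0 < gcd y N
  0<gcd[y,N] y = ℕₚ.n≢0⇒n>0 (gcd[m,n]≢0 y N (inj₂ (ℕ.≢-nonZero⁻¹ N)))

  gcd[y,N]-nonZero : ∀ y → NonZero (gcd y N)
  gcd[y,N]-nonZero y = ℕ.>-nonZero (0<gcd[y,N] y)

  nonZero-factor : ∀ {m n} → N ≡ m ℕ.* n → NonZero m
  nonZero-factor {m} N≡mn = ℕₚ.m*n≢0⇒m≢0 m {{≡.subst NonZero N≡mn it}}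

  ζ^-multiple : ∀ {k} → N ∣ k → ζ ^ k ≈ 1#
  ζ^-multiple {k} (divides q k≡qN) = begin
    ζ ^ k         ≡⟨ ≡.cong (ζ ^_) (≡.trans k≡qN (ℕₚ.*-comm q N)) ⟩
    ζ ^ (N ℕ.* q) ≈⟨ ^-* ζ N q ⟩
    (ζ ^ N) ^ q   ≈⟨ ^-≈1 (proj₁ ζ-primitive) q ⟩
    1#            ∎

  ζ^≉1 : ∀ {k} → ¬ N ∣ k → ζ ^ k ≉ 1#
  ζ^≉1 {k} N∤k ζᵏ≈1 =
    proj₂ ζ-primitive (k % N) 0<k%N (m%n<n k N) (trans (sym (^≈^% N (proj₁ ζ-primitive) k)) ζᵏ≈1)
    where
    0<k%N : 0 < k % N
    0<k%N = ℕₚ.n≢0⇒n>0 (N∤k ∘ ∣.m%n≡0⇒n∣m k N)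

  ∑<-ζ^-powers : ∀ k n → N ∣ k ℕ.* n → ∑< n (λ j → ζ ^ (k ℕ.* j)) ≈ 𝟙 (N ∣? k) * fromℕ n
  ∑<-ζ^-powers k n N∣kn with N ∣? k
  ... | yes N∣k = begin
    ∑< n (λ j → ζ ^ (k ℕ.* j)) ≈⟨ ∑<-cong n (λ j _ → ζ^-multiple (∣.∣m⇒∣m*n j N∣k)) ⟩
    ∑< n (λ _ → 1#)            ≈⟨ ∑<-1 n ⟩
    fromℕ n                    ≈⟨ *-identityˡ _ ⟨
    1# * fromℕ n               ∎
  ... | no N∤k = begin
    ∑< n (λ j → ζ ^ (k ℕ.* j)) ≈⟨ ∑<-cong n (λ j _ → ^-* ζ k j) ⟩
    ∑< n ((ζ ^ k) ^_)          ≈⟨ ∑<-geometric-root n (ζ^≉1 N∤k) (trans (sym (^-* ζ k n)) (ζ^-multiple N∣kn)) ⟩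
    0#                         ≈⟨ zeroˡ _ ⟨
    0# * fromℕ n               ∎

  orthogonality : ∀ w → ∑< N (λ x → ζ ^ (x ℕ.* w)) ≈ 𝟙 (N ∣? w) * fromℕ N
  orthogonality w = trans (∑<-cong N (λ x _ → reflexive (≡.cong (ζ ^_) (ℕₚ.*-comm x w))))
                          (∑<-ζ^-powers w N (∣.n∣m*n w))

  multiplesSum : ℕ → ℕ → Carrier
  multiplesSum m u = ∑< N (λ y → 𝟙 (m ∣? y) * ζ ^ (y ℕ.* u))

  multiplesSum-eval : ∀ {m n} u → N ≡ m ℕ.* n → multiplesSum m u ≈ 𝟙 (n ∣? u) * fromℕ n
  multiplesSum-eval {m} {n} u N≡mn = begin
    multiplesSum m u
      ≡⟨ ≡.cong (λ t → ∑< t (λ y → 𝟙 (m ∣? y) * ζ ^ (y ℕ.* u))) N≡mn ⟩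
    ∑< (m ℕ.* n) (λ y → 𝟙 (m ∣? y) * ζ ^ (y ℕ.* u))
      ≈⟨ ∑<-multiples m n (λ y → ζ ^ (y ℕ.* u)) ⟩
    ∑< n (λ j → ζ ^ (m ℕ.* j ℕ.* u))
      ≈⟨ ∑<-cong n (λ j _ → reflexive (≡.cong (ζ ^_) (*-rightComm m j u))) ⟩
    ∑< n (λ j → ζ ^ (m ℕ.* u ℕ.* j))
      ≈⟨ ∑<-ζ^-powers (m ℕ.* u) n N∣mun ⟩
    𝟙 (N ∣? m ℕ.* u) * fromℕ n
      ≈⟨ *-congʳ (𝟙-cong (N ∣? m ℕ.* u) (n ∣? u) N∣mu⇒n∣u (≡.subst (_∣ m ℕ.* u) (≡.sym N≡mn) ∘ ∣.*-monoʳ-∣ m)) ⟩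
    𝟙 (n ∣? u) * fromℕ n ∎
    where
    instance _ = nonZero-factor N≡mn
    N∣mu⇒n∣u : N ∣ m ℕ.* u → n ∣ u
    N∣mu⇒n∣u N∣mu = ∣.*-cancelˡ-∣ m (≡.subst (_∣ m ℕ.* u) N≡mn N∣mu)
    N∣mun : N ∣ m ℕ.* u ℕ.* n
    N∣mun = ≡.subst (N ∣_) (≡.trans (≡.cong (ℕ._* u) N≡mn) (*-rightComm m n u))
                    (∣.m∣m*n u)

  multiplesSum-invariant : ∀ {m u u′} → m ∣ N → gcd u N ≡ gcd u′ N →
                           multiplesSum m u ≈ multiplesSum m u′
  multiplesSum-invariant {m} {u} {u′} (divides n N≡nm) gcd≡ = begin
    multiplesSum m u     ≈⟨ multiplesSum-eval {m} {n} u N≡mn ⟩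
    𝟙 (n ∣? u) * fromℕ n  ≈⟨ *-congʳ (𝟙-cong (n ∣? u) (n ∣? u′) (∣-respects-gcd n∣N gcd≡)
                                                             (∣-respects-gcd n∣N (≡.sym gcd≡))) ⟩
    𝟙 (n ∣? u′) * fromℕ n ≈⟨ multiplesSum-eval {m} {n} u′ N≡mn ⟨
    multiplesSum m u′    ∎
    where
    N≡mn = ≡.trans N≡nm (ℕₚ.*-comm n m)
    n∣N  = divides m N≡mn

  gcdClassSum : ℕ → ℕ → Carrier
  gcdClassSum m u = ∑< N (λ y → 𝟙 (gcd y N ℕ.≟ m) * ζ ^ (y ℕ.* u))

  properMultiple? : ∀ m s → Dec (m ∣ s × s ≢ m)
  properMultiple? m s = m ∣? s ×-dec ¬? (s ℕ.≟ m)

  properMultiplesSum : ℕ → ℕ → Carrier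
  properMultiplesSum m u = ∑< N (λ i → 𝟙 (properMultiple? m (suc i)) * gcdClassSum (suc i) u)

  multiplesSum≈∑gcdClassSum : ∀ {m} u → m ∣ N →
    multiplesSum m u ≈ ∑< N (λ i → 𝟙 (m ∣? suc i) * gcdClassSum (suc i) u)
  multiplesSum≈∑gcdClassSum {m} u m∣N = begin
    ∑< N (λ y → 𝟙 (m ∣? y) * ζ ^ (y ℕ.* u))
      ≈⟨ ∑<-cong N (λ y _ → sym (classes-collapse y)) ⟩
    ∑< N (λ y → ∑< N (λ i → h y (suc i)))
      ≈⟨ ∑<-comm N N (λ y i → h y (suc i)) ⟩
    ∑< N (λ i → ∑< N (λ y → 𝟙 (m ∣? suc i) * (𝟙 (gcd y N ℕ.≟ suc i) * ζ ^ (y ℕ.* u))))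
      ≈⟨ ∑<-cong N (λ i _ → sym (*-distribˡ-∑< N (𝟙 (m ∣? suc i))
                                  (λ y → 𝟙 (gcd y N ℕ.≟ suc i) * ζ ^ (y ℕ.* u)))) ⟩
    ∑< N (λ i → 𝟙 (m ∣? suc i) * gcdClassSum (suc i) u) ∎
    where
    h : ℕ → ℕ → Carrier
    h y s = 𝟙 (m ∣? s) * (𝟙 (gcd y N ℕ.≟ s) * ζ ^ (y ℕ.* u))
    classes-collapse : ∀ y → ∑< N (λ i → h y (suc i)) ≈ 𝟙 (m ∣? y) * ζ ^ (y ℕ.* u)
    classes-collapse y = begin
      ∑< N (λ i → h y (suc i))
        ≈⟨ ∑<-suc-single N (h y) (0<gcd[y,N] y) (gcd[m,n]≤n y N) (λ j _ gcd≢ →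
             trans (*-congˡ (𝟙*-no (gcd y N ℕ.≟ suc j) (gcd≢ ∘ ≡.sym) _)) (zeroʳ _)) ⟩
      𝟙 (m ∣? gcd y N) * (𝟙 (gcd y N ℕ.≟ gcd y N) * ζ ^ (y ℕ.* u))
        ≈⟨ *-cong (𝟙-cong (m ∣? gcd y N) (m ∣? y) (λ m∣g → ∣.∣-trans m∣g (gcd[m,n]∣m y N))
                                                   (λ m∣y → gcd-greatest m∣y m∣N))
                  (𝟙*-yes (gcd y N ℕ.≟ gcd y N) ≡.refl _) ⟩
      𝟙 (m ∣? y) * ζ ^ (y ℕ.* u) ∎

  multiplesSum-split : ∀ {m} u → m ∣ N → multiplesSum m u ≈ gcdClassSum m u + properMultiplesSum m u
  multiplesSum-split {m} u m∣N = begin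
    multiplesSum m u
      ≈⟨ multiplesSum≈∑gcdClassSum u m∣N ⟩
    ∑< N (λ i → 𝟙 (m ∣? suc i) * G (suc i))
      ≈⟨ ∑<-cong N (λ i _ →
           trans (*-congʳ {G (suc i)} (𝟙-split (m ∣? suc i) (suc i ℕ.≟ m) (∣.∣-reflexive ∘ ≡.sym)))
                 (distribʳ _ _ _)) ⟩
    ∑< N (λ i → 𝟙 (suc i ℕ.≟ m) * G (suc i) + 𝟙 (properMultiple? m (suc i)) * G (suc i))
      ≈⟨ ∑-distrib-+ {N} _ _ ⟩
    ∑< N (λ i → 𝟙 (suc i ℕ.≟ m) * G (suc i)) + properMultiplesSum m u
      ≈⟨ +-congʳ (∑<-suc-single N (λ s → 𝟙 (s ℕ.≟ m) * G s) 0<m (∣.∣⇒≤ m∣N)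
                                 (λ j _ s≢m → 𝟙*-no (suc j ℕ.≟ m) s≢m _)) ⟩
    𝟙 (m ℕ.≟ m) * G m + properMultiplesSum m u
      ≈⟨ +-congʳ (𝟙*-yes (m ℕ.≟ m) ≡.refl _) ⟩
    gcdClassSum m u + properMultiplesSum m u ∎
    where
    G = λ s → gcdClassSum s u
    0<m : 0 < m
    0<m = ℕₚ.n≢0⇒n>0 λ m≡0 → ℕ.≢-nonZero⁻¹ N (∣.0∣⇒≡0 (≡.subst (_∣ N) m≡0 m∣N))

  gcdClassSum-∤ : ∀ {m} u → ¬ m ∣ N → gcdClassSum m u ≈ 0#
  gcdClassSum-∤ {m} u m∤N = ∑<-zero N (λ y _ →
    𝟙*-no (gcd y N ℕ.≟ m) (λ gcd≡m → m∤N (≡.subst (_∣ N) gcd≡m (gcd[m,n]∣n y N))) (ζ ^ (y ℕ.* u)))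

  gcdClassSum-invariant : ∀ m {u u′} → gcd u N ≡ gcd u′ N → gcdClassSum m u ≈ gcdClassSum m u′
  gcdClassSum-invariant m = go m (<-wellFounded (N ∸ m))
    where
    go : ∀ m → Acc _<_ (N ∸ m) → ∀ {u u′} → gcd u N ≡ gcd u′ N →
         gcdClassSum m u ≈ gcdClassSum m u′
    go m (acc rec) {u} {u′} gcd≡ with m ∣? N
    ... | no m∤N  = trans (gcdClassSum-∤ u m∤N) (sym (gcdClassSum-∤ u′ m∤N))
    ... | yes m∣N = +-cancelʳ (properMultiplesSum m u) _ _ (begin
      gcdClassSum m u + properMultiplesSum m u
        ≈⟨ multiplesSum-split u m∣N ⟨
      multiplesSum m u
        ≈⟨ multiplesSum-invariant m∣N gcd≡ ⟩
      multiplesSum m u′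
        ≈⟨ multiplesSum-split u′ m∣N ⟩
      gcdClassSum m u′ + properMultiplesSum m u′
        ≈⟨ +-congˡ (∑<-cong N λ i i<N → term i i<N (properMultiple? m (suc i))) ⟨
      gcdClassSum m u′ + properMultiplesSum m u ∎)
      where
      term : ∀ i → i < N → (s? : Dec (m ∣ suc i × suc i ≢ m)) →
             𝟙 s? * gcdClassSum (suc i) u ≈ 𝟙 s? * gcdClassSum (suc i) u′
      term i i<N (yes (m∣s , s≢m)) =
        *-congˡ (go (suc i) (rec (ℕₚ.∸-monoʳ-< (ℕₚ.≤∧≢⇒< (∣.∣⇒≤ m∣s) (s≢m ∘ ≡.sym)) i<N)) gcd≡)
      term i i<N (no _) = trans (zeroˡ _) (sym (zeroˡ _))

  classSize : ℕ → Carrier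
  classSize m = ∑< N (λ y → 𝟙 (gcd y N ℕ.≟ m))

  classSize≈φ : ∀ {m n} → N ≡ m ℕ.* n → classSize m ≈ fromℕ (φ n)
  classSize≈φ {m} {n} N≡mn = begin
    classSize m
      ≈⟨ ∑<-cong N (λ y _ → sym (𝟙*𝟙-absorb (gcd y N ℕ.≟ m) (m ∣? y)
                                  (λ gcd≡m → ≡.subst (_∣ y) gcd≡m (gcd[m,n]∣m y N)))) ⟩
    ∑< N (λ y → 𝟙 (m ∣? y) * 𝟙 (gcd y N ℕ.≟ m))
      ≡⟨ ≡.cong (λ t → ∑< t (λ y → 𝟙 (m ∣? y) * 𝟙 (gcd y N ℕ.≟ m))) N≡mn ⟩
    ∑< (m ℕ.* n) (λ y → 𝟙 (m ∣? y) * 𝟙 (gcd y N ℕ.≟ m))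
      ≈⟨ ∑<-multiples m n (λ y → 𝟙 (gcd y N ℕ.≟ m)) ⟩
    ∑< n (λ j → 𝟙 (gcd (m ℕ.* j) N ℕ.≟ m))
      ≈⟨ ∑<-cong n (λ j _ → 𝟙-cong (gcd (m ℕ.* j) N ℕ.≟ m) (gcd j n ℕ.≟ 1) (to j) (from j)) ⟩
    ∑< n (λ j → 𝟙 (gcd j n ℕ.≟ 1))
      ≈⟨ φ≈∑< n ⟨
    fromℕ (φ n) ∎
    where
    instance _ = nonZero-factor N≡mn
    gcd[mj,N]≡m*gcd[j,n] : ∀ j → gcd (m ℕ.* j) N ≡ m ℕ.* gcd j n
    gcd[mj,N]≡m*gcd[j,n] j = ≡.trans (≡.cong (gcd (m ℕ.* j)) N≡mn) (≡.sym (c*gcd[m,n]≡gcd[cm,cn] m j n))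
    to : ∀ j → gcd (m ℕ.* j) N ≡ m → gcd j n ≡ 1
    to j gcd≡m = ℕₚ.*-cancelˡ-≡ (gcd j n) 1 m
      (≡.trans (≡.sym (gcd[mj,N]≡m*gcd[j,n] j)) (≡.trans gcd≡m (≡.sym (ℕₚ.*-identityʳ m))))
    from : ∀ j → gcd j n ≡ 1 → gcd (m ℕ.* j) N ≡ m
    from j gcd≡1 = ≡.trans (gcd[mj,N]≡m*gcd[j,n] j) (≡.trans (≡.cong (m ℕ.*_) gcd≡1) (ℕₚ.*-identityʳ m))

  classSize≈φ[N/d] : ∀ {d} .{{_ : NonZero d}} → d ∣ N → classSize d ≈ fromℕ (φ (N / d))
  classSize≈φ[N/d] d∣N = classSize≈φ (≡.sym (m*[n/m]≡n d∣N))

  classSize≉0 : ∀ {m} → m ∣ N → classSize m ≉ 0#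
  classSize≉0 {m} (divides n N≡nm) size≈0 =
    fromℕ≉0 (φ≢0 n≢0) (trans (sym (classSize≈φ (≡.trans N≡nm (ℕₚ.*-comm n m)))) size≈0)
    where
    n≢0 : n ≢ 0
    n≢0 n≡0 = ℕ.≢-nonZero⁻¹ N (≡.trans N≡nm (≡.cong (ℕ._* m) n≡0))

module Kernels {c ℓ} (F : CharZeroField c ℓ) (N : ℕ) .{{_ : NonZero N}}
               (ζ : CharZeroField.Carrier F) (ζ-primitive : Over.IsPrimitiveRoot F N ζ) where
  open CharZeroField F
  open Over F
  open CharZeroFieldProperties F
  open PrimitiveRoot F N ζ ζ-primitive
  open import Relation.Binary.Reasoning.Setoid setoid

  gcdKernel : ℕ → ℕ → Carrier
  gcdKernel x y = 𝟙 (gcd y N ℕ.≟ gcd x N) * classSize (gcd x N) ⁻¹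

  gcdKernel-comm : ∀ x y → gcdKernel x y ≈ gcdKernel y x
  gcdKernel-comm x y with gcd y N ℕ.≟ gcd x N | gcd x N ℕ.≟ gcd y N
  ... | yes gy≡gx | yes _     = *-congˡ (reflexive (≡.cong (λ g → classSize g ⁻¹) (≡.sym gy≡gx)))
  ... | yes gy≡gx | no gx≢gy = ⊥-elim (gx≢gy (≡.sym gy≡gx))
  ... | no gy≢gx  | yes gx≡gy = ⊥-elim (gy≢gx (≡.sym gx≡gy))
  ... | no _      | no _      = trans (zeroˡ _) (sym (zeroˡ _))

  gcdKernel-transform : ∀ x v → ∑< N (λ y → gcdKernel x y * ζ ^ (y ℕ.* v)) ≈
                                 classSize (gcd x N) ⁻¹ * gcdClassSum (gcd x N) v
  gcdKernel-transform x v = begin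
    ∑< N (λ y → 𝟙 (gcd y N ℕ.≟ gcd x N) * classSize (gcd x N) ⁻¹ * ζ ^ (y ℕ.* v))
      ≈⟨ ∑<-cong N (λ y _ → xy∙z≈y∙xz (𝟙 (gcd y N ℕ.≟ gcd x N)) (classSize (gcd x N) ⁻¹) (ζ ^ (y ℕ.* v))) ⟩
    ∑< N (λ y → classSize (gcd x N) ⁻¹ * (𝟙 (gcd y N ℕ.≟ gcd x N) * ζ ^ (y ℕ.* v)))
      ≈⟨ *-distribˡ-∑< N _ (λ y → 𝟙 (gcd y N ℕ.≟ gcd x N) * ζ ^ (y ℕ.* v)) ⟨
    classSize (gcd x N) ⁻¹ * gcdClassSum (gcd x N) v ∎

  classPairSum : ℕ → ℕ → Carrier
  classPairSum a b = ∑< N (λ z → 𝟙 (gcd z N ℕ.≟ b) * gcdClassSum a z)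

  classPairSum-comm : ∀ a b → classPairSum a b ≈ classPairSum b a
  classPairSum-comm a b = begin
    ∑< N (λ z → 𝟙 (gcd z N ℕ.≟ b) * ∑< N (λ y → 𝟙 (gcd y N ℕ.≟ a) * ζ ^ (y ℕ.* z)))
      ≈⟨ ∑<-∑<-swap-factor N (λ z → 𝟙 (gcd z N ℕ.≟ b)) (λ y → 𝟙 (gcd y N ℕ.≟ a))
                              (λ z y → ζ ^ (y ℕ.* z)) ⟩
    ∑< N (λ y → 𝟙 (gcd y N ℕ.≟ a) * ∑< N (λ z → 𝟙 (gcd z N ℕ.≟ b) * ζ ^ (y ℕ.* z)))
      ≈⟨ ∑<-cong N (λ y _ → *-congˡ {𝟙 (gcd y N ℕ.≟ a)} (∑<-cong N (λ z _ → *-congˡ {𝟙 (gcd z N ℕ.≟ b)}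
                                                              (reflexive (≡.cong (ζ ^_) (ℕₚ.*-comm y z)))))) ⟩
    ∑< N (λ y → 𝟙 (gcd y N ℕ.≟ a) * ∑< N (λ z → 𝟙 (gcd z N ℕ.≟ b) * ζ ^ (z ℕ.* y))) ∎

  classPairSum-eval : ∀ a z₀ → classPairSum a (gcd z₀ N) ≈ classSize (gcd z₀ N) * gcdClassSum a z₀
  classPairSum-eval a z₀ = begin
    ∑< N (λ z → 𝟙 (gcd z N ℕ.≟ gcd z₀ N) * gcdClassSum a z)
      ≈⟨ ∑<-cong N (λ z _ → 𝟙*-cong (gcd z N ℕ.≟ gcd z₀ N) (gcdClassSum-invariant a {z} {z₀})) ⟩
    ∑< N (λ z → 𝟙 (gcd z N ℕ.≟ gcd z₀ N) * gcdClassSum a z₀)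
      ≈⟨ *-distribʳ-∑< N _ (λ z → 𝟙 (gcd z N ℕ.≟ gcd z₀ N)) ⟨
    classSize (gcd z₀ N) * gcdClassSum a z₀ ∎

  gcdKernel-transform-comm : ∀ x v → ∑< N (λ y → gcdKernel x y * ζ ^ (y ℕ.* v)) ≈
                                      ∑< N (λ y → gcdKernel v y * ζ ^ (y ℕ.* x))
  gcdKernel-transform-comm x v = begin
    ∑< N (λ y → gcdKernel x y * ζ ^ (y ℕ.* v))
      ≈⟨ gcdKernel-transform x v ⟩
    classSize (gcd x N) ⁻¹ * gcdClassSum (gcd x N) v
      ≈⟨ ⁻¹*-cross _ _ (classSize≉0 (gcd[m,n]∣n x N)) (classSize≉0 (gcd[m,n]∣n v N)) cross ⟩
    classSize (gcd v N) ⁻¹ * gcdClassSum (gcd v N) x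
      ≈⟨ gcdKernel-transform v x ⟨
    ∑< N (λ y → gcdKernel v y * ζ ^ (y ℕ.* x)) ∎
    where
    cross : classSize (gcd v N) * gcdClassSum (gcd x N) v ≈ classSize (gcd x N) * gcdClassSum (gcd v N) x
    cross = begin
      classSize (gcd v N) * gcdClassSum (gcd x N) v ≈⟨ classPairSum-eval (gcd x N) v ⟨
      classPairSum (gcd x N) (gcd v N)              ≈⟨ classPairSum-comm (gcd x N) (gcd v N) ⟩
      classPairSum (gcd v N) (gcd x N)              ≈⟨ classPairSum-eval (gcd v N) x ⟩
      classSize (gcd x N) * gcdClassSum (gcd v N) x ∎

  -- Defs writes the divisor m as suc (m ∸ 1) to keep N / m total; it is m for every m ≥ 1.
  divisorKernel : ℕ → ℕ → Carrier
  divisorKernel u v =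
    ∑∣ N (λ m → fromℕ (φ (N / suc (m ∸ 1))) ⁻¹ * (𝟙 (gcd u N ℕ.≟ m) * 𝟙 (gcd v N ℕ.≟ m)))

  divisorKernel≈gcdKernel : ∀ u v → divisorKernel u v ≈ gcdKernel u v
  divisorKernel≈gcdKernel u v = begin
    divisorKernel u v
      ≈⟨ ∑∣-single N (λ m → fromℕ (φ (N / suc (m ∸ 1))) ⁻¹ * (𝟙 (gcd u N ℕ.≟ m) * 𝟙 (gcd v N ℕ.≟ m)))
                   (gcd[m,n]∣n u N) (λ m m≢g →
           trans (*-congˡ (𝟙*-no (gcd u N ℕ.≟ m) (m≢g ∘ ≡.sym) (𝟙 (gcd v N ℕ.≟ m)))) (zeroʳ _)) ⟩
    fromℕ (φ (N / suc (g ∸ 1))) ⁻¹ * (𝟙 (g ℕ.≟ g) * 𝟙 (gcd v N ℕ.≟ g))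
      ≈⟨ *-cong (sym (⁻¹-cong φ≈classSize (classSize≉0 (gcd[m,n]∣n u N)))) (𝟙*-yes (g ℕ.≟ g) ≡.refl _) ⟩
    classSize g ⁻¹ * 𝟙 (gcd v N ℕ.≟ g)
      ≈⟨ *-comm _ _ ⟩
    gcdKernel u v ∎
    where
    g = gcd u N
    instance _ = gcd[y,N]-nonZero u
    φ≈classSize : classSize g ≈ fromℕ (φ (N / suc (g ∸ 1)))
    φ≈classSize = trans (classSize≈φ[N/d] {g} (gcd[m,n]∣n u N))
                        (reflexive (≡.cong (fromℕ ∘ φ) (/-congʳ {m = N} (≡.sym (ℕₚ.suc-pred g)))))

  -- The Ramanujan sum c_d(u): the ζˣ with gcd(x,N)·d = N are the primitive d-th roots of unity.
  ramanujanSum : ℕ → ℕ → Carrier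
  ramanujanSum d u = ∑< N (λ x → 𝟙 (gcd x N ℕ.* d ℕ.≟ N) * ζ ^ (x ℕ.* u))

  ramanujanKernel : ℕ → ℕ → Carrier
  ramanujanKernel u v = ∑∣ N (λ d → fromℕ (N ℕ.* φ d) ⁻¹ * (ramanujanSum d u * ramanujanSum d v))

  ramanujanWeight : ℕ → ℕ → Carrier
  ramanujanWeight x y =
    ∑∣ N (λ d → fromℕ (N ℕ.* φ d) ⁻¹ * (𝟙 (gcd x N ℕ.* d ℕ.≟ N) * 𝟙 (gcd y N ℕ.* d ℕ.≟ N)))

  ramanujanKernel≈∑∑weight : ∀ u v → ramanujanKernel u v ≈
    ∑< N (λ x → ∑< N (λ y → (ζ ^ (x ℕ.* u) * ζ ^ (y ℕ.* v)) * ramanujanWeight x y))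
  ramanujanKernel≈∑∑weight u v = trans
    (∑∣-*-sum N {N} {N} κ (λ d x → 𝟙 (gcd (toℕ x) N ℕ.* d ℕ.≟ N) * ζ ^ (toℕ x ℕ.* u))
                  (λ d y → 𝟙 (gcd (toℕ y) N ℕ.* d ℕ.≟ N) * ζ ^ (toℕ y ℕ.* v)))
    (sum-cong-≋ {N} λ x → sum-cong-≋ {N} λ y →
       ∑∣-*-pull N κ (λ d → 𝟙 (gcd (toℕ x) N ℕ.* d ℕ.≟ N)) (λ d → 𝟙 (gcd (toℕ y) N ℕ.* d ℕ.≟ N))
                     (ζ ^ (toℕ x ℕ.* u)) (ζ ^ (toℕ y ℕ.* v)))
    where
    κ = λ d → fromℕ (N ℕ.* φ d) ⁻¹

  ramanujanWeight≈gcdKernel : ∀ x y → ramanujanWeight x y ≈ fromℕ N ⁻¹ * gcdKernel x y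
  ramanujanWeight≈gcdKernel x y = begin
    ramanujanWeight x y
      ≈⟨ ∑∣-single N (λ d → fromℕ (N ℕ.* φ d) ⁻¹ * (𝟙 (g ℕ.* d ℕ.≟ N) * 𝟙 (gcd y N ℕ.* d ℕ.≟ N))) d₀∣N
           (λ d d≢d₀ → trans (*-congˡ (𝟙*-no (g ℕ.* d ℕ.≟ N) (d≢d₀ ∘ cancel) _)) (zeroʳ _)) ⟩
    fromℕ (N ℕ.* φ d₀) ⁻¹ * (𝟙 (g ℕ.* d₀ ℕ.≟ N) * 𝟙 (gcd y N ℕ.* d₀ ℕ.≟ N))
      ≈⟨ *-cong weight≈ (trans (𝟙*-yes (g ℕ.* d₀ ℕ.≟ N) g*d₀≡N _)
                              (𝟙-cong (gcd y N ℕ.* d₀ ℕ.≟ N) (gcd y N ℕ.≟ g) cancelʳ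
                                      (λ e → ≡.trans (≡.cong (ℕ._* d₀) e) g*d₀≡N))) ⟩
    (fromℕ N ⁻¹ * classSize g ⁻¹) * 𝟙 (gcd y N ℕ.≟ g)
      ≈⟨ trans (*-assoc _ _ _) (*-congˡ (*-comm _ _)) ⟩
    fromℕ N ⁻¹ * gcdKernel x y ∎
    where
    g = gcd x N
    instance _ = gcd[y,N]-nonZero x
    d₀ = N / g
    instance
      d₀≢0 : NonZero d₀
      d₀≢0 = ℕ.≢-nonZero (n/gcd[m,n]≢0 x N)
    g∣N : g ∣ N
    g∣N = gcd[m,n]∣n x N
    g*d₀≡N : g ℕ.* d₀ ≡ N
    g*d₀≡N = m*[n/m]≡n g∣N
    d₀∣N : d₀ ∣ N
    d₀∣N = divides g (≡.sym g*d₀≡N)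
    cancel : ∀ {d} → g ℕ.* d ≡ N → d ≡ d₀
    cancel g*d≡N = ℕₚ.*-cancelˡ-≡ _ _ g (≡.trans g*d≡N (≡.sym g*d₀≡N))
    cancelʳ : ∀ {g′} → g′ ℕ.* d₀ ≡ N → g′ ≡ g
    cancelʳ g′*d₀≡N = ℕₚ.*-cancelʳ-≡ _ _ d₀ (≡.trans g′*d₀≡N (≡.sym g*d₀≡N))
    N*φ≈N*size : fromℕ (N ℕ.* φ d₀) ≈ fromℕ N * classSize g
    N*φ≈N*size = trans (fromℕ-* N (φ d₀)) (*-congˡ (sym (classSize≈φ[N/d] g∣N)))
    N≉0 : fromℕ N ≉ 0#
    N≉0 = fromℕ≉0 (ℕ.≢-nonZero⁻¹ N)
    N*size≉0 : fromℕ N * classSize g ≉ 0#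
    N*size≉0 = ≉0-* N≉0 (classSize≉0 g∣N)
    weight≈ : fromℕ (N ℕ.* φ d₀) ⁻¹ ≈ fromℕ N ⁻¹ * classSize g ⁻¹
    weight≈ = trans (⁻¹-cong N*φ≈N*size (N*size≉0 ∘ trans (sym N*φ≈N*size)))
                    (⁻¹-distrib-* N≉0 (classSize≉0 g∣N))

  ∑<-gcdKernel-at-negate : ∀ {u} v → u < N → ∑< N (λ y → 𝟙 (N ∣? u ℕ.+ y) * gcdKernel v y) ≈ gcdKernel u v
  ∑<-gcdKernel-at-negate {u} v u<N = begin
    ∑< N (λ y → 𝟙 (N ∣? u ℕ.+ y) * gcdKernel v y)
      ≈⟨ ∑<-single N (λ y → 𝟙 (N ∣? u ℕ.+ y) * gcdKernel v y) (negate N u) (negate-< u<N) (λ y y<N y≢ →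
           𝟙*-no (N ∣? u ℕ.+ y) (y≢ ∘ negate-unique u<N y<N) _) ⟩
    𝟙 (N ∣? u ℕ.+ negate N u) * gcdKernel v (negate N u)
      ≈⟨ 𝟙*-yes (N ∣? u ℕ.+ negate N u) (∣+negate u<N) _ ⟩
    gcdKernel v (negate N u)
      ≡⟨ ≡.cong (λ g → 𝟙 (g ℕ.≟ gcd v N) * classSize (gcd v N) ⁻¹) (gcd-negate u<N) ⟩
    gcdKernel v u
      ≈⟨ gcdKernel-comm v u ⟩
    gcdKernel u v ∎

  ramanujanKernel≈gcdKernel : ∀ {u} v → u < N → ramanujanKernel u v ≈ gcdKernel u v
  ramanujanKernel≈gcdKernel {u} v u<N = begin
    ramanujanKernel u v
      ≈⟨ ramanujanKernel≈∑∑weight u v ⟩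
    ∑< N (λ x → ∑< N (λ y → (ζ ^ (x ℕ.* u) * ζ ^ (y ℕ.* v)) * ramanujanWeight x y))
      ≈⟨ ∑<-cong N (λ x _ → ∑<-cong N (λ y _ →
           *-congˡ {ζ ^ (x ℕ.* u) * ζ ^ (y ℕ.* v)} (ramanujanWeight≈gcdKernel x y))) ⟩
    ∑< N (λ x → ∑< N (λ y → (ζ ^ (x ℕ.* u) * ζ ^ (y ℕ.* v)) * (N⁻¹ * gcdKernel x y)))
      ≈⟨ ∑<-∑<-factor N N⁻¹ (λ x → ζ ^ (x ℕ.* u)) (λ y → ζ ^ (y ℕ.* v)) gcdKernel ⟩
    N⁻¹ * ∑< N (λ x → ζ ^ (x ℕ.* u) * ∑< N (λ y → gcdKernel x y * ζ ^ (y ℕ.* v)))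
      ≈⟨ *-congˡ (∑<-cong N (λ x _ → *-congˡ {ζ ^ (x ℕ.* u)} (gcdKernel-transform-comm x v))) ⟩
    N⁻¹ * ∑< N (λ x → ζ ^ (x ℕ.* u) * ∑< N (λ y → gcdKernel v y * ζ ^ (y ℕ.* x)))
      ≈⟨ *-congˡ (∑<-∑<-swap-factor N (λ x → ζ ^ (x ℕ.* u)) (gcdKernel v) (λ x y → ζ ^ (y ℕ.* x))) ⟩
    N⁻¹ * ∑< N (λ y → gcdKernel v y * ∑< N (λ x → ζ ^ (x ℕ.* u) * ζ ^ (y ℕ.* x)))
      ≈⟨ *-congˡ (∑<-cong N (λ y _ → *-congˡ {gcdKernel v y}
                     (trans (∑<-cong N (λ x _ → ζ^-merge x y)) (orthogonality (u ℕ.+ y))))) ⟩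
    N⁻¹ * ∑< N (λ y → gcdKernel v y * (𝟙 (N ∣? u ℕ.+ y) * fromℕ N))
      ≈⟨ trans (*-distribˡ-∑< N N⁻¹ (λ y → gcdKernel v y * (𝟙 (N ∣? u ℕ.+ y) * fromℕ N)))
               (∑<-cong N (λ y _ → cancel-N (gcdKernel v y) (𝟙 (N ∣? u ℕ.+ y)))) ⟩
    ∑< N (λ y → 𝟙 (N ∣? u ℕ.+ y) * gcdKernel v y)
      ≈⟨ ∑<-gcdKernel-at-negate v u<N ⟩
    gcdKernel u v ∎
    where
    N⁻¹ = fromℕ N ⁻¹
    ζ^-merge : ∀ x y → ζ ^ (x ℕ.* u) * ζ ^ (y ℕ.* x) ≈ ζ ^ (x ℕ.* (u ℕ.+ y))
    ζ^-merge x y = begin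
      ζ ^ (x ℕ.* u) * ζ ^ (y ℕ.* x)   ≈⟨ ^-+ ζ (x ℕ.* u) (y ℕ.* x) ⟨
      ζ ^ (x ℕ.* u ℕ.+ y ℕ.* x)       ≡⟨ ≡.cong (λ e → ζ ^ (x ℕ.* u ℕ.+ e)) (ℕₚ.*-comm y x) ⟩
      ζ ^ (x ℕ.* u ℕ.+ x ℕ.* y)       ≡⟨ ≡.cong (ζ ^_) (ℕₚ.*-distribˡ-+ x u y) ⟨
      ζ ^ (x ℕ.* (u ℕ.+ y))           ∎
    cancel-N : ∀ k e → N⁻¹ * (k * (e * fromℕ N)) ≈ e * k
    cancel-N k e = begin
      N⁻¹ * (k * (e * fromℕ N))   ≈⟨ *-congˡ (trans (*-congˡ (*-comm e _)) (x∙yz≈y∙xz k _ e)) ⟩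
      N⁻¹ * (fromℕ N * (k * e))   ≈⟨ x⁻¹*[x*y]≈y _ (fromℕ≉0 (ℕ.≢-nonZero⁻¹ N)) ⟩
      k * e                       ≈⟨ *-comm k e ⟩
      e * k                       ∎

  divisorKernel≈ramanujanKernel : ∀ {u} v → u < N → divisorKernel u v ≈ ramanujanKernel u v
  divisorKernel≈ramanujanKernel {u} v u<N =
    trans (divisorKernel≈gcdKernel u v) (sym (ramanujanKernel≈gcdKernel v u<N))

module Expansion {c ℓ} (F : CharZeroField c ℓ) (N : ℕ) .{{_ : NonZero N}}
                 (ζ : CharZeroField.Carrier F) (ζ-primitive : Over.IsPrimitiveRoot F N ζ) where
  open CharZeroField F
  open Over F
  open CharZeroFieldProperties F
  open PrimitiveRoot F N ζ ζ-primitive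
  open Kernels F N ζ ζ-primitive
  open import Relation.Binary.Reasoning.Setoid setoid

  ∑² : (Fin N → Fin N → Carrier) → Carrier
  ∑² f = sum (λ a → sum (f a))

  residue : Fin N → Fin N → ℕ
  residue a c = (toℕ a ℕ.+ N ∸ toℕ c) % N

  weight : (Fin N → ℤ) → (Fin N → ℤ) → Fin N → Fin N → Carrier
  weight wA wC a c = fromℤ (wA a) * fromℤ (wC c)

  ζ^-residue : ∀ x a c → x ≤ N → c < N →
               (ζ ^ x) ^ a * (ζ ^ (N ∸ x)) ^ c ≈ ζ ^ (x ℕ.* ((a ℕ.+ N ∸ c) % N))
  ζ^-residue x a c x≤N c<N = begin
    (ζ ^ x) ^ a * (ζ ^ (N ∸ x)) ^ c   ≈⟨ ^-*-inverse ζ^[N∸x]*ζ^x≈1 [ζ^x]^N≈1 a c c≤a+N ⟩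
    (ζ ^ x) ^ (a ℕ.+ N ∸ c)           ≈⟨ ^≈^% N [ζ^x]^N≈1 (a ℕ.+ N ∸ c) ⟩
    (ζ ^ x) ^ ((a ℕ.+ N ∸ c) % N)     ≈⟨ ^-* ζ x _ ⟨
    ζ ^ (x ℕ.* ((a ℕ.+ N ∸ c) % N))   ∎
    where
    ζ^[N∸x]*ζ^x≈1 : ζ ^ (N ∸ x) * ζ ^ x ≈ 1#
    ζ^[N∸x]*ζ^x≈1 = trans (sym (^-+ ζ (N ∸ x) x))
                          (trans (reflexive (≡.cong (ζ ^_) (ℕₚ.m∸n+n≡m x≤N))) (proj₁ ζ-primitive))
    [ζ^x]^N≈1 : (ζ ^ x) ^ N ≈ 1#
    [ζ^x]^N≈1 = trans (sym (^-* ζ x N)) (ζ^-multiple (∣.n∣m*n x))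
    c≤a+N : c ≤ a ℕ.+ N
    c≤a+N = ℕₚ.≤-trans (ℕₚ.<⇒≤ c<N) (ℕₚ.m≤n+m N a)

  eval*eval : ∀ wA wC x → x ≤ N → eval N wA (ζ ^ x) * eval N wC (ζ ^ (N ∸ x)) ≈
                                    ∑² (λ a c → ζ ^ (x ℕ.* residue a c) * weight wA wC a c)
  eval*eval wA wC x x≤N = begin
    eval N wA (ζ ^ x) * eval N wC (ζ ^ (N ∸ x))
      ≡⟨ ≡.cong₂ _*_ (∑≡sum N _) (∑≡sum N _) ⟩
    sum (λ a → fromℤ (wA a) * (ζ ^ x) ^ toℕ a) * sum (λ c → fromℤ (wC c) * (ζ ^ (N ∸ x)) ^ toℕ c)
      ≈⟨ sum-*-sum {N} {N} _ _ ⟩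
    ∑² (λ a c → (fromℤ (wA a) * (ζ ^ x) ^ toℕ a) * (fromℤ (wC c) * (ζ ^ (N ∸ x)) ^ toℕ c))
      ≈⟨ sum-cong-≋ {N} (λ a → sum-cong-≋ {N} λ c → trans (interchange _ _ _ _) (trans (*-comm _ _)
           (*-congʳ (ζ^-residue x (toℕ a) (toℕ c) x≤N (Finₚ.toℕ<n c))))) ⟩
    ∑² (λ a c → ζ ^ (x ℕ.* residue a c) * weight wA wC a c) ∎

  S≈∑²ramanujanSum : ∀ wA wC d →
                     S N ζ d wA wC ≈ ∑² (λ a c → ramanujanSum d (residue a c) * weight wA wC a c)
  S≈∑²ramanujanSum wA wC d = begin
    S N ζ d wA wC
      ≡⟨ ∑≡sum N _ ⟩
    ∑< N (λ x → if does (e? x) then eval N wA (ζ ^ x) * eval N wC (ζ ^ (N ∸ x)) else 0#)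
      ≈⟨ ∑<-cong N (λ x x<N → trans (if-does≈𝟙* (e? x) _) (*-congˡ (eval*eval wA wC x (ℕₚ.<⇒≤ x<N)))) ⟩
    ∑< N (λ x → 𝟙 (e? x) * ∑² (λ a c → ζ ^ (x ℕ.* residue a c) * W a c))
      ≈⟨ ∑<-cong N (λ x _ → trans (*-distribˡ-sum {N} (𝟙 (e? x)) _) (sum-cong-≋ {N} λ a →
           trans (*-distribˡ-sum {N} (𝟙 (e? x)) _) (sum-cong-≋ {N} λ c →
             sym (*-assoc (𝟙 (e? x)) (ζ ^ (x ℕ.* residue a c)) (W a c))))) ⟩
    ∑< N (λ x → ∑² (λ a c → (𝟙 (e? x) * ζ ^ (x ℕ.* residue a c)) * W a c))
      ≈⟨ trans (∑-comm {N} {N} _) (sum-cong-≋ {N} λ a → ∑-comm {N} {N} _) ⟩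
    ∑² (λ a c → ∑< N (λ x → (𝟙 (e? x) * ζ ^ (x ℕ.* residue a c)) * W a c))
      ≈⟨ sum-cong-≋ {N} (λ a → sum-cong-≋ {N} λ c →
           sym (*-distribʳ-∑< N (W a c) (λ x → 𝟙 (e? x) * ζ ^ (x ℕ.* residue a c)))) ⟩
    ∑² (λ a c → ramanujanSum d (residue a c) * W a c) ∎
    where
    W = weight wA wC
    e? : ∀ x → Dec (gcd x N ℕ.* d ≡ N)
    e? x = gcd x N ℕ.* d ℕ.≟ N

  𝔸≈∑²indicator : ∀ wA wC m →
                  fromℤ (𝔸 N wA wC m) ≈ ∑² (λ a c → 𝟙 (gcd (residue a c) N ℕ.≟ m) * weight wA wC a c)
  𝔸≈∑²indicator wA wC m =
    trans (fromℤ-sumℤ N _) (sum-cong-≋ {N} λ a → trans (fromℤ-sumℤ N _) (sum-cong-≋ {N} λ c →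
    trans (fromℤ-if-does (gcd (residue a c) N ℕ.≟ m) _) (*-congˡ (fromℤ-* (wA a) (wC c)))))

  ∑∣-expand : ∀ (κ : ℕ → Carrier) (α β : ℕ → Fin N → Fin N → Carrier)
                (W W′ : Fin N → Fin N → Carrier) →
    ∑∣ N (λ m → κ m * (∑² (λ a c → α m a c * W a c) * ∑² (λ b e → β m b e * W′ b e))) ≈
    ∑² (λ a b → ∑² (λ c e → (W a c * W′ b e) * ∑∣ N (λ m → κ m * (α m a c * β m b e))))
  ∑∣-expand κ α β W W′ = begin
    ∑∣ N (λ m → κ m * (∑² (λ a c → α m a c * W a c) * ∑² (λ b e → β m b e * W′ b e)))
      ≈⟨ ∑∣-*-sum N {N} {N} κ (λ m a → sum (λ c → α m a c * W a c))
                                (λ m b → sum (λ e → β m b e * W′ b e)) ⟩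
    ∑² (λ a b → ∑∣ N (λ m → κ m * (sum (λ c → α m a c * W a c) * sum (λ e → β m b e * W′ b e))))
      ≈⟨ sum-cong-≋ {N} (λ a → sum-cong-≋ {N} λ b →
           trans (∑∣-*-sum N {N} {N} κ (λ m c → α m a c * W a c) (λ m e → β m b e * W′ b e))
                 (sum-cong-≋ {N} λ c → sum-cong-≋ {N} λ e →
                    ∑∣-*-pull N κ (λ m → α m a c) (λ m → β m b e) (W a c) (W′ b e))) ⟩
    ∑² (λ a b → ∑² (λ c e → (W a c * W′ b e) * ∑∣ N (λ m → κ m * (α m a c * β m b e)))) ∎

  LHS≈RHS : ∀ wA wB wC wD → LHS N wA wB wC wD ≈ RHS N ζ wA wB wC wD
  LHS≈RHS wA wB wC wD = begin
    LHS N wA wB wC wD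
      ≈⟨ ∑∣-cong N _ (λ m → κ m * (∑² (λ a c → 𝟙 (gcd (residue a c) N ℕ.≟ m) * W a c) *
                                   ∑² (λ b e → 𝟙 (gcd (residue b e) N ℕ.≟ m) * W′ b e)))
           (λ m → *-congˡ (*-cong (𝔸≈∑²indicator wA wC m) (𝔸≈∑²indicator wB wD m))) ⟩
    _ ≈⟨ ∑∣-expand κ (λ m a c → 𝟙 (gcd (residue a c) N ℕ.≟ m))
                     (λ m b e → 𝟙 (gcd (residue b e) N ℕ.≟ m)) W W′ ⟩
    ∑² (λ a b → ∑² (λ c e → (W a c * W′ b e) * divisorKernel (residue a c) (residue b e)))
      ≈⟨ sum-cong-≋ {N} (λ a → sum-cong-≋ {N} λ b → sum-cong-≋ {N} λ c → sum-cong-≋ {N} λ e →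
           *-congˡ (divisorKernel≈ramanujanKernel (residue b e) (m%n<n _ N))) ⟩
    ∑² (λ a b → ∑² (λ c e → (W a c * W′ b e) * ramanujanKernel (residue a c) (residue b e)))
      ≈⟨ ∑∣-expand κ′ (λ d a c → ramanujanSum d (residue a c))
                      (λ d b e → ramanujanSum d (residue b e)) W W′ ⟨
    _ ≈⟨ ∑∣-cong N (λ d → κ′ d * (S N ζ d wA wC * S N ζ d wB wD)) _
           (λ d → *-congˡ (*-cong (S≈∑²ramanujanSum wA wC d) (S≈∑²ramanujanSum wB wD d))) ⟨
    RHS N ζ wA wB wC wD ∎
    where
    W  = weight wA wC
    W′ = weight wB wD
    κ  = λ m → fromℕ (φ (N / suc (m ∸ 1))) ⁻¹
    κ′ = λ d → fromℕ (N ℕ.* φ d) ⁻¹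

mainTheorem4 : ∀ {c ℓ} (F : CharZeroField c ℓ) (N : ℕ) .{{_ : NonZero N}}
                 (ζ : CharZeroField.Carrier F) → Over.IsPrimitiveRoot F N ζ →
                 (wA wB wC wD : Fin N → ℤ) →
                 (CharZeroField._≈_ F (Over.LHS F N wA wB wC wD) (Over.RHS F N ζ wA wB wC wD))
                 × (CharZeroField._≈_ F (Over.LHS F N wA wB wA wB) (Over.RHS𝓔 F N ζ wA wB))
mainTheorem4 F N ζ ζ-primitive wA wB wC wD = LHS≈RHS wA wB wC wD , LHS≈RHS wA wB wA wB
  where open Expansion F N ζ ζ-primitive
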